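{- Fix a positive integer $n$. Let $A$ be the matrix whose rows and columns are indexed by the compositions of $n$, ordered by $\blacktriangleright$ (decreasing), with entry $A_{\alpha\beta}$ equal to the coefficient of $M_\beta$ in $\mathcal S_\alpha$. Then $A_{\alpha\beta}$ is the number of ComTs of shape $\alpha$ and weight $\beta$. Furthermore $A_{\alpha\beta}=0$ if $\beta\blacktriangleright\alpha$, and $A_{\alpha\alpha}=1$.
   Context: A weak composition is a finite sequence $\gamma=(\gamma_1,\dots,\gamma_n)$ of nonnegative integers; a composition has all parts positive; $\alpha(\gamma)$ is obtained from $\gamma$ by deleting zero parts; $\lambda(\gamma)$ is the partition obtained by sorting positive parts weakly decreasingly. $\alpha>_{lex}\beta$ means $\alpha\ne\beta$ and at the first index $i$ where they differ, $\alpha_i>\beta_i$. $\alpha\blacktriangleright\beta$ means $\lambda(\alpha)>_{lex}\lambda(\beta)$, or $\lambda(\alpha)=\lambda(\beta)$ and $\alpha>_{lex}\beta$. For a composition $\beta=(\beta_1,\dots,\beta_k)$, $M_\beta=\sum_{i_1<\dots<i_k}x_{i_1}^{\beta_1}\cdots x_{i_k}^{\beta_k}$. Quasisymmetric Schur functions. The augmented diagram of $\gamma=(\gamma_1,\dots,\gamma_n)$ has cells $(i,j)$, $1\le i\le n$ (row, from top), $0\le j\le\gamma_i$ (column); column $0$ is the basement, cell $(i,0)$ containing $i$. An augmented filling assigns positive integers to non-basement cells. Cells $(i,j),(i',j')$ attack if $j=j'$, or $j=j'+1$ and $i>i'$; non-attacking means distinct attacking cells (basement included) have distinct entries. When comparing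 entries in a triple, of two equal entries the one appearing first when read top to bottom, right to left counts as smaller. Type A triple: $c=(i,k-1)$, $a=(i,k)$, $b=(j,k)$, $i<j$, $k\ge1$, $\gamma_i\ge\gamma_j$; inversion triple if in increasing order $a<c<b$, $c<b<a$ or $b<a<c$. Type B triple: $a=(i,k)$, $b=(j,k)$, $c=(j,k+1)$, $i<j$, $k\ge0$, $\gamma_j>\gamma_i$; inversion triple if in increasing order $a<c<b$, $c<b<a$ or $b<a<c$. An SSAF of shape $\gamma$ is a non-attacking augmented filling with rows (basement included) weakly decreasing left to right and all type A and B triples inversion triples; $x^F=\prod_i x_i^{w_i(F)}$, $w_i(F)$ the number of non-basement cells containing $i$. $\mathcal A_\gamma=\sum_F x^F$ over SSAFs of shape $\gamma$; $\mathcal S_\alpha=\sum_\gamma\mathcal A_\gamma$ over weak compositions $\gamma$ with positive last part and $\alpha(\gamma)=\alpha$. ComTs. For a composition $\alpha=(\alpha_1,\dots,\alpha_\ell)$ with largest part $m$, a ComT of shape $\alpha$ is a filling of the left-justified diagram with $\alpha_i$ cells in row $i$ by positive integers with rows weakly decreasing left to right, leftmost column strictly increasing top to bottom, and such that, padding rows with $0$'s to an $\ell\times m$ array $\hat T$, for $1\le i<j\le\ell$, $2\le k\le m$: $\hat T(j,k)\ne0$ and $\hat T(j,k)\ge\hat T(i,k)$ imply $\hat T(j,k)>\hat T(i,k-1)$. Its weight is $\beta$ if, for each $i$, the number of cells containing $i$ is $\beta_i$ (and $0$ for $i>\ell(\beta)$). -}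

module Defs where

open import Data.Bool using (Bool; true; false; _∧_; _∨_; not; if_then_else_; T)
open import Data.Nat using (ℕ; zero; suc; _+_; _∸_; _<_; _≡ᵇ_; _<ᵇ_; _≤ᵇ_; _⊔_)
open import Data.List using (List; []; _∷_; length; map; upTo; concat)
open import Data.Nat.ListAction using (sum)
open import Data.List.Relation.Unary.All using (All)
open import Data.Product using (Σ; _×_; _,_; proj₁; proj₂)
open import Data.Sum using (_⊎_)
open import Data.Empty using (⊥)
open import Relation.Binary.PropositionalEquality using (_≡_)

-- All conditions on fillings are Bool-valued so that the subtypes below
-- (Σ data (T check)) have proof-irrelevant second components; counting
-- ("the number of ...") is then expressed by bijections  X ↔ Fin m.

-- 1-indexed lookup in a list of naturals; 0 when out of range.
get0 : List ℕ → ℕ → ℕ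
get0 []       _             = 0
get0 (x ∷ xs) zero          = 0
get0 (x ∷ xs) (suc zero)    = x
get0 (x ∷ xs) (suc (suc i)) = get0 xs (suc i)

-- 1-indexed row of a filling; [] when out of range.
rowOf : List (List ℕ) → ℕ → List ℕ
rowOf []       _             = []
rowOf (r ∷ rs) zero          = []
rowOf (r ∷ rs) (suc zero)    = r
rowOf (r ∷ rs) (suc (suc i)) = rowOf rs (suc i)

all : (ℕ → Bool) → List ℕ → Bool
all p []       = true
all p (x ∷ xs) = p x ∧ all p xs

range : ℕ → ℕ → List ℕ
range lo hi = map (lo +_) (upTo (suc hi ∸ lo))

allIn : ℕ → ℕ → (ℕ → Bool) → Bool
allIn lo hi p = all p (range lo hi)

_⇒ᵇ_ : Bool → Bool → Bool
a ⇒ᵇ b = not a ∨ b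

eqL : List ℕ → List ℕ → Bool
eqL []       []       = true
eqL (x ∷ xs) (y ∷ ys) = (x ≡ᵇ y) ∧ eqL xs ys
eqL _        _        = false

maxL : List ℕ → ℕ
maxL []       = 0
maxL (x ∷ xs) = x ⊔ maxL xs

countOcc : ℕ → List ℕ → ℕ
countOcc i []       = 0
countOcc i (x ∷ xs) = if i ≡ᵇ x then suc (countOcc i xs) else countOcc i xs

IsComposition : ℕ → List ℕ → Set
IsComposition n α = All (λ x → 0 < x) α × sum α ≡ n

delZeros : List ℕ → List ℕ
delZeros []            = []
delZeros (zero ∷ xs)   = delZeros xs
delZeros (suc x ∷ xs)  = suc x ∷ delZeros xs

lastPositive : List ℕ → Bool
lastPositive []           = false
lastPositive (x ∷ [])     = 0 <ᵇ x
lastPositive (x ∷ y ∷ xs) = lastPositive (y ∷ xs)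

insertDec : ℕ → List ℕ → List ℕ
insertDec x []       = x ∷ []
insertDec x (y ∷ ys) = if y ≤ᵇ x then x ∷ y ∷ ys else y ∷ insertDec x ys

sortDec : List ℕ → List ℕ
sortDec []       = []
sortDec (x ∷ xs) = insertDec x (sortDec xs)

partitionOf : List ℕ → List ℕ
partitionOf γ = sortDec (delZeros γ)

_>lex_ : List ℕ → List ℕ → Set
[]       >lex _        = ⊥
(a ∷ as) >lex []       = ⊥
(a ∷ as) >lex (b ∷ bs) = (b < a) ⊎ (a ≡ b × as >lex bs)

_▶_ : List ℕ → List ℕ → Set
α ▶ β = (partitionOf α >lex partitionOf β) ⊎ (partitionOf α ≡ partitionOf β × α >lex β)

weightOK : List ℕ → List ℕ → Bool
weightOK β xs = all (λ x → x ≤ᵇ length β) xs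
              ∧ allIn 1 (length β) (λ i → countOcc i xs ≡ᵇ get0 β i)

-- A filling of shape γ = (γ_1,…,γ_n) is a list F of n rows, row i being
-- the list of entries of cells (i,1),…,(i,γ_i) (left to right).
-- Cell (i,0) is the basement, containing i.

module _ (γ : List ℕ) (F : List (List ℕ)) where

  private
    nr : ℕ
    nr = length γ

    len : ℕ → ℕ
    len i = get0 γ i

  isCell : ℕ → ℕ → Bool
  isCell i j = (1 ≤ᵇ i) ∧ (i ≤ᵇ nr) ∧ (j ≤ᵇ len i)

  val : ℕ → ℕ → ℕ
  val i j = if j ≡ᵇ 0 then i else get0 (rowOf F i) j

  -- cell (i,j) comes before (i',j') in reading order (top to bottom, right to left)
  readsBefore : ℕ → ℕ → ℕ → ℕ → Bool
  readsBefore i j i' j' = (i <ᵇ i') ∨ ((i ≡ᵇ i') ∧ (j' <ᵇ j))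

  cellLess : ℕ → ℕ → ℕ → ℕ → Bool
  cellLess i j i' j' = (val i j <ᵇ val i' j')
                     ∨ ((val i j ≡ᵇ val i' j') ∧ readsBefore i j i' j')

  invTriple : ℕ → ℕ → ℕ → ℕ → ℕ → ℕ → Bool
  invTriple ai aj bi bj ci cj =
      (cellLess ai aj ci cj ∧ cellLess ci cj bi bj)
    ∨ (cellLess ci cj bi bj ∧ cellLess bi bj ai aj)
    ∨ (cellLess bi bj ai aj ∧ cellLess ai aj ci cj)

  shapeOK : Bool
  shapeOK = (length F ≡ᵇ nr)
          ∧ allIn 1 nr (λ i → (length (rowOf F i) ≡ᵇ len i)
                              ∧ all (λ x → 1 ≤ᵇ x) (rowOf F i))

  rowsDecreasing : Bool
  rowsDecreasing = allIn 1 nr (λ i → allIn 1 (len i) (λ j → val i j ≤ᵇ val i (j ∸ 1)))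

  nonAttacking : Bool
  nonAttacking =
    allIn 1 nr (λ i → allIn 1 nr (λ i' → allIn 0 (len i) (λ j →
        (((i <ᵇ i') ∧ isCell i' j) ⇒ᵇ not (val i j ≡ᵇ val i' j))
      ∧ (((i' <ᵇ i) ∧ (1 ≤ᵇ j) ∧ isCell i' (j ∸ 1)) ⇒ᵇ not (val i j ≡ᵇ val i' (j ∸ 1))))))

  typeAOK : Bool
  typeAOK =
    allIn 1 nr (λ i → allIn 1 nr (λ j → allIn 1 (len j) (λ k →
      ((i <ᵇ j) ∧ (len j ≤ᵇ len i)) ⇒ᵇ invTriple i k j k i (k ∸ 1))))

  typeBOK : Bool
  typeBOK =
    allIn 1 nr (λ i → allIn 1 nr (λ j → allIn 0 (len i) (λ k →
      ((i <ᵇ j) ∧ (len i <ᵇ len j)) ⇒ᵇ invTriple i k j k j (suc k))))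

  isSSAF : Bool
  isSSAF = shapeOK ∧ rowsDecreasing ∧ nonAttacking ∧ typeAOK ∧ typeBOK

-- Pairs (γ, F): γ a weak composition with positive last part and α(γ) = α,
-- F an SSAF of shape γ with x^F = x_1^{β_1} ⋯ x_ℓ^{β_ℓ}.
-- The number of such pairs is the coefficient of x_1^{β_1}⋯x_ℓ^{β_ℓ} in S_α,
-- i.e. the coefficient of M_β in S_α (the entry A_{αβ}).
SSAFsOfWeight : List ℕ → List ℕ → Set
SSAFsOfWeight α β =
  Σ (List ℕ × List (List ℕ)) λ p →
    T (lastPositive (proj₁ p) ∧ eqL (delZeros (proj₁ p)) α
       ∧ isSSAF (proj₁ p) (proj₂ p) ∧ weightOK β (concat (proj₂ p)))

module _ (α : List ℕ) (t : List (List ℕ)) where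

  private
    ℓ : ℕ
    ℓ = length α

    m : ℕ
    m = maxL α

    -- padded array  T̂(i,k)  (0 outside the diagram)
    That : ℕ → ℕ → ℕ
    That i k = get0 (rowOf t i) k

  isComT : Bool
  isComT =
      (length t ≡ᵇ ℓ)
    ∧ allIn 1 ℓ (λ i → (length (rowOf t i) ≡ᵇ get0 α i) ∧ all (λ x → 1 ≤ᵇ x) (rowOf t i))
    ∧ allIn 1 ℓ (λ i → allIn 2 (get0 α i) (λ k → That i k ≤ᵇ That i (k ∸ 1)))
    ∧ allIn 1 (ℓ ∸ 1) (λ i → That i 1 <ᵇ That (suc i) 1)
    ∧ allIn 1 ℓ (λ i → allIn 1 ℓ (λ j → allIn 2 m (λ k →
        ((i <ᵇ j) ∧ not (That j k ≡ᵇ 0) ∧ (That i k ≤ᵇ That j k))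
          ⇒ᵇ (That i (k ∸ 1) <ᵇ That j k))))

ComTsOfWeight : List ℕ → List ℕ → Set
ComTsOfWeight α β = Σ (List (List ℕ)) λ t → T (isComT α t ∧ weightOK β (concat t))

module Submission where

-- In an SSAF the basement forces the first entry of a nonempty row i to be
-- i: it is at most i because rows decrease, and it is not below i because the
-- cell would attack the basement of an earlier row.  Deleting the empty rows
-- therefore loses no information, and for two rows i < j the non-attacking
-- and triple conditions of the SSAF are together equivalent to the triple
-- condition of a ComT; this gives the bijection between SSAFs contributing
-- x^β to S_α and ComTs of shape α and weight β.
--
-- Triangularity is a counting argument on ComTs.  The entries of a column
-- are distinct, so a value v occupies at most m cells in the first m columns
-- and at least β_v − m cells beyond column m; summing over v gives
-- Σ_v (β_v ∸ m) ≤ Σ_i (α_i ∸ m) for every m, which fails for some m when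
-- λ(β) >lex λ(α).  When λ(β) = λ(α) these inequalities are equalities, so
-- every value v fills one cell in each of the columns 1, …, β_v.  By
-- induction the rows before the first index p where β and α differ are
-- constant (row i consists of α_i copies of i), and then the value p has no
-- room in column α_p + 1.  The same induction shows that the only ComT of
-- weight α is the constant one.

open import Defs
open import Data.Bool using (Bool; true; false; T; _∧_; _∨_; not; if_then_else_)
open import Data.Bool.Properties using (T-irrelevant)
open import Data.Empty using (⊥; ⊥-elim)
open import Data.Fin using (Fin; zero)
open import Data.List using (List; []; _∷_; length; map; applyUpTo; concat; _++_; replicate)
open import Data.List.Properties using (length-map; length-replicate; map-++; map-applyUpTo)
open import Data.List.Relation.Unary.All as All using (All; []; _∷_)
open import Data.List.Relation.Unary.AllPairs using (AllPairs; []; _∷_)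
open import Data.Nat
open import Data.Nat.ListAction using (sum)
open import Data.Nat.Properties
open import Data.Product using (Σ; _×_; _,_; proj₁; proj₂; ∃-syntax)
open import Data.Sum using (_⊎_; inj₁; inj₂)
open import Data.Unit using (tt; ⊤)
open import Function.Bundles using (_↔_; mk↔ₛ′)
open import Relation.Binary.Definitions using (tri<; tri≈; tri>)
open import Relation.Binary.PropositionalEquality
open import Relation.Nullary using (¬_; yes; no)
open import Algebra.Properties.CommutativeSemigroup +-commutativeSemigroup using (interchange)

∧-intro : ∀ {a b} → T a → T b → T (a ∧ b)
∧-intro {true} _ y = y

∧-fst : ∀ {a b} → T (a ∧ b) → T a
∧-fst {true} _ = tt

∧-snd : ∀ {a b} → T (a ∧ b) → T b
∧-snd {true} y = y

∨-inl : ∀ {a b} → T a → T (a ∨ b)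
∨-inl {true} _ = tt

∨-inr : ∀ {a b} → T b → T (a ∨ b)
∨-inr {true} _ = tt
∨-inr {false} y = y

∨-elim : ∀ {a b} → T (a ∨ b) → T a ⊎ T b
∨-elim {true} _ = inj₁ tt
∨-elim {false} y = inj₂ y

⇒ᵇ-intro : ∀ {a b} → (T a → T b) → T (a ⇒ᵇ b)
⇒ᵇ-intro {true} f = f tt
⇒ᵇ-intro {false} f = tt

⇒ᵇ-elim : ∀ {a b} → T (a ⇒ᵇ b) → T a → T b
⇒ᵇ-elim {true} h _ = h

T⇒≡true : ∀ {a} → T a → a ≡ true
T⇒≡true {true} _ = refl

¬T⇒≡false : ∀ {a} → ¬ T a → a ≡ false
¬T⇒≡false {true} f = ⊥-elim (f tt)
¬T⇒≡false {false} f = refl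

≢⇒T-not-≡ᵇ : ∀ {m n} → m ≢ n → T (not (m ≡ᵇ n))
≢⇒T-not-≡ᵇ {m} {n} m≢n = subst (λ b → T (not b)) (sym (¬T⇒≡false (λ t → m≢n (≡ᵇ⇒≡ m n t)))) tt

T-not-≡ᵇ⇒≢ : ∀ {m n} → T (not (m ≡ᵇ n)) → m ≢ n
T-not-≡ᵇ⇒≢ {m} {n} h m≡n = subst (λ b → T (not b)) (T⇒≡true (≡⇒≡ᵇ m n m≡n)) h

≡ᵇ-sym : ∀ m n → (m ≡ᵇ n) ≡ (n ≡ᵇ m)
≡ᵇ-sym zero zero = refl
≡ᵇ-sym zero (suc n) = refl
≡ᵇ-sym (suc m) zero = refl
≡ᵇ-sym (suc m) (suc n) = ≡ᵇ-sym m n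

Σ-T-≡ : ∀ {A : Set} {P : A → Bool} {x y : A} {px : T (P x)} {py : T (P y)} →
  x ≡ y → _≡_ {A = Σ A (λ z → T (P z))} (x , px) (y , py)
Σ-T-≡ {x = x} {px = px} {py} refl = cong (x ,_) (T-irrelevant px py)

get0-zero : ∀ xs → get0 xs 0 ≡ 0
get0-zero [] = refl
get0-zero (x ∷ xs) = refl

get0-outOfRange : ∀ xs k → length xs < k → get0 xs k ≡ 0
get0-outOfRange [] k _ = refl
get0-outOfRange (x ∷ xs) (suc (suc k)) (s≤s l) = get0-outOfRange xs (suc k) l

get0≤maxL : ∀ xs i → get0 xs i ≤ maxL xs
get0≤maxL [] i = z≤n
get0≤maxL (x ∷ xs) zero = z≤n
get0≤maxL (x ∷ xs) (suc zero) = m≤m⊔n x (maxL xs)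
get0≤maxL (x ∷ xs) (suc (suc i)) = ≤-trans (get0≤maxL xs (suc i)) (m≤n⊔m x (maxL xs))

get0-ext : ∀ (r r' : List ℕ) → length r ≡ length r' →
  (∀ k → 1 ≤ k → k ≤ length r → get0 r k ≡ get0 r' k) → r ≡ r'
get0-ext [] [] _ _ = refl
get0-ext (x ∷ xs) (y ∷ ys) e h = cong₂ _∷_ (h 1 ≤-refl (s≤s z≤n))
  (get0-ext xs ys (suc-injective e) (λ { (suc k) _ kl → h (suc (suc k)) (s≤s z≤n) (s≤s kl) }))

get0-replicate : ∀ a x k → 1 ≤ k → k ≤ a → get0 (replicate a x) k ≡ x
get0-replicate (suc a) x (suc zero) _ _ = refl
get0-replicate (suc a) x (suc (suc k)) _ (s≤s ka) = get0-replicate a x (suc k) (s≤s z≤n) ka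

get0-replicate-0⊎ : ∀ a x k → get0 (replicate a x) k ≡ 0 ⊎ get0 (replicate a x) k ≡ x
get0-replicate-0⊎ zero x k = inj₁ refl
get0-replicate-0⊎ (suc a) x zero = inj₁ refl
get0-replicate-0⊎ (suc a) x (suc zero) = inj₂ refl
get0-replicate-0⊎ (suc a) x (suc (suc k)) = get0-replicate-0⊎ a x (suc k)

All-get0 : ∀ {P : ℕ → Set} xs → All P xs → ∀ i → 1 ≤ i → i ≤ length xs → P (get0 xs i)
All-get0 (x ∷ xs) (h ∷ hs) (suc zero) _ _ = h
All-get0 (x ∷ xs) (h ∷ hs) (suc (suc i)) _ (s≤s il) = All-get0 xs hs (suc i) (s≤s z≤n) il

rowOf-zero : ∀ (t : List (List ℕ)) → rowOf t 0 ≡ []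
rowOf-zero [] = refl
rowOf-zero (r ∷ rs) = refl

rowOf-outOfRange : ∀ (t : List (List ℕ)) i → length t < i → rowOf t i ≡ []
rowOf-outOfRange [] i _ = refl
rowOf-outOfRange (r ∷ rs) (suc (suc i)) (s≤s l) = rowOf-outOfRange rs (suc i) l

rowOf-ext : ∀ (t t' : List (List ℕ)) → length t ≡ length t' →
  (∀ k → 1 ≤ k → k ≤ length t → rowOf t k ≡ rowOf t' k) → t ≡ t'
rowOf-ext [] [] _ _ = refl
rowOf-ext (x ∷ xs) (y ∷ ys) e h = cong₂ _∷_ (h 1 ≤-refl (s≤s z≤n))
  (rowOf-ext xs ys (suc-injective e) (λ { (suc k) _ kl → h (suc (suc k)) (s≤s z≤n) (s≤s kl) }))

get0-map-length : ∀ (t : List (List ℕ)) i → get0 (map length t) i ≡ length (rowOf t i)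
get0-map-length [] i = refl
get0-map-length (r ∷ t) zero = refl
get0-map-length (r ∷ t) (suc zero) = refl
get0-map-length (r ∷ t) (suc (suc i)) = get0-map-length t (suc i)

All-rowOf : ∀ {U : List ℕ → Set} t → All U t → ∀ p → 1 ≤ p → p ≤ length t → U (rowOf t p)
All-rowOf (x ∷ xs) (u ∷ _) (suc zero) _ _ = u
All-rowOf (x ∷ xs) (_ ∷ us) (suc (suc p)) _ (s≤s pl) = All-rowOf xs us (suc p) (s≤s z≤n) pl

rowOf-All : ∀ {U : List ℕ → Set} t → (∀ p → 1 ≤ p → p ≤ length t → U (rowOf t p)) → All U t
rowOf-All [] h = []
rowOf-All (x ∷ xs) h = h 1 ≤-refl (s≤s z≤n) ∷ rowOf-All xs (λ { (suc p) _ pl → h (suc (suc p)) (s≤s z≤n) (s≤s pl) })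

AllPairs-rowOf : ∀ {R : List ℕ → List ℕ → Set} t → AllPairs R t →
  ∀ p q → 1 ≤ p → p < q → q ≤ length t → R (rowOf t p) (rowOf t q)
AllPairs-rowOf (x ∷ xs) _ (suc zero) (suc zero) _ (s≤s ()) _
AllPairs-rowOf (x ∷ xs) (a ∷ _) (suc zero) (suc (suc q)) _ _ (s≤s ql) = All-rowOf xs a (suc q) (s≤s z≤n) ql
AllPairs-rowOf (x ∷ xs) (_ ∷ h) (suc (suc p)) (suc (suc q)) _ (s≤s pq) (s≤s ql) =
  AllPairs-rowOf xs h (suc p) (suc q) (s≤s z≤n) pq ql

rowOf-AllPairs : ∀ {R : List ℕ → List ℕ → Set} t →
  (∀ p q → 1 ≤ p → p < q → q ≤ length t → R (rowOf t p) (rowOf t q)) → AllPairs R t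
rowOf-AllPairs [] h = []
rowOf-AllPairs (x ∷ xs) h =
  rowOf-All xs (λ { (suc q) _ ql → h 1 (suc (suc q)) ≤-refl (s≤s (s≤s z≤n)) (s≤s ql) })
  ∷ rowOf-AllPairs xs (λ { (suc p) (suc q) _ pq ql → h (suc (suc p)) (suc (suc q)) (s≤s z≤n) (s≤s pq) (s≤s ql) })

all-get0 : ∀ {p : ℕ → Bool} r → T (all p r) → ∀ k → 1 ≤ k → k ≤ length r → T (p (get0 r k))
all-get0 {p} (x ∷ xs) h (suc zero) _ _ = ∧-fst {p x} h
all-get0 {p} (x ∷ xs) h (suc (suc k)) _ (s≤s kl) = all-get0 xs (∧-snd {p x} h) (suc k) (s≤s z≤n) kl

get0-all : ∀ {p : ℕ → Bool} r → (∀ k → 1 ≤ k → k ≤ length r → T (p (get0 r k))) → T (all p r)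
get0-all [] h = tt
get0-all (x ∷ xs) h = ∧-intro (h 1 ≤-refl (s≤s z≤n)) (get0-all xs (λ { (suc k) _ kl → h (suc (suc k)) (s≤s z≤n) (s≤s kl) }))

all-++⁻ : ∀ {p : ℕ → Bool} xs ys → T (all p (xs ++ ys)) → T (all p xs) × T (all p ys)
all-++⁻ [] ys h = tt , h
all-++⁻ {p} (x ∷ xs) ys h with all-++⁻ xs ys (∧-snd {p x} h)
... | hxs , hys = ∧-intro (∧-fst {p x} h) hxs , hys

all-++⁺ : ∀ {p : ℕ → Bool} xs ys → T (all p xs) → T (all p ys) → T (all p (xs ++ ys))
all-++⁺ [] ys _ h = h
all-++⁺ {p} (x ∷ xs) ys hx hy = ∧-intro (∧-fst {p x} hx) (all-++⁺ xs ys (∧-snd {p x} hx) hy)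

all-concat⁻ : ∀ {p : ℕ → Bool} (t : List (List ℕ)) → T (all p (concat t)) → ∀ i → T (all p (rowOf t i))
all-concat⁻ [] h i = tt
all-concat⁻ (r ∷ rs) h zero = tt
all-concat⁻ (r ∷ rs) h (suc zero) = proj₁ (all-++⁻ r (concat rs) h)
all-concat⁻ (r ∷ rs) h (suc (suc i)) = all-concat⁻ rs (proj₂ (all-++⁻ r (concat rs) h)) (suc i)

all-replicate : ∀ {p : ℕ → Bool} a x → T (p x) → T (all p (replicate a x))
all-replicate zero x h = tt
all-replicate (suc a) x h = ∧-intro h (all-replicate a x h)

all-applyUpTo : ∀ (p : ℕ → Bool) (f : ℕ → ℕ) n →
  T (all p (applyUpTo f n)) → ∀ d → d < n → T (p (f d))
all-applyUpTo p f (suc n) h zero _ = ∧-fst {p (f 0)} h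
all-applyUpTo p f (suc n) h (suc d) (s≤s d<n) = all-applyUpTo p (λ x → f (suc x)) n (∧-snd {p (f 0)} h) d d<n

applyUpTo-all : ∀ (p : ℕ → Bool) (f : ℕ → ℕ) n →
  (∀ d → d < n → T (p (f d))) → T (all p (applyUpTo f n))
applyUpTo-all p f zero h = tt
applyUpTo-all p f (suc n) h =
  ∧-intro (h 0 (s≤s z≤n)) (applyUpTo-all p (λ x → f (suc x)) n (λ d d<n → h (suc d) (s≤s d<n)))

range≡applyUpTo : ∀ lo hi → range lo hi ≡ applyUpTo (lo +_) (suc hi ∸ lo)
range≡applyUpTo lo hi = map-applyUpTo (λ x → x) (lo +_) (suc hi ∸ lo)

allIn-elim : ∀ {lo hi p} → T (allIn lo hi p) → ∀ i → lo ≤ i → i ≤ hi → T (p i)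
allIn-elim {lo} {hi} {p} h i lo≤i i≤hi =
  subst (λ z → T (p z)) (m+[n∸m]≡n lo≤i)
    (all-applyUpTo p (lo +_) (suc hi ∸ lo) (subst (λ l → T (all p l)) (range≡applyUpTo lo hi) h)
      (i ∸ lo) (∸-monoˡ-< (s≤s i≤hi) lo≤i))

allIn-intro : ∀ {lo hi p} → (∀ i → lo ≤ i → i ≤ hi → T (p i)) → T (allIn lo hi p)
allIn-intro {lo} {hi} {p} h = subst (λ l → T (all p l)) (sym (range≡applyUpTo lo hi))
  (applyUpTo-all p (lo +_) (suc hi ∸ lo) (λ d d< → h (lo + d) (m≤m+n lo d) (lo+d≤hi d d<)))
  where
  lo+d≤hi : ∀ d → d < suc hi ∸ lo → lo + d ≤ hi
  lo+d≤hi d d< = ≤-pred (≤-trans (+-monoʳ-< lo d<) (≤-reflexive (m+[n∸m]≡n lo≤1+hi)))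
    where
    lo≤1+hi : lo ≤ suc hi
    lo≤1+hi with lo ≤? suc hi
    ... | yes q = q
    ... | no q = ⊥-elim (<⇒≱ d< (≤-trans (≤-reflexive (m≤n⇒m∸n≡0 (<⇒≤ (≰⇒> q)))) z≤n))

-- Finite sums and occurrence counts

sumFrom : ℕ → ℕ → (ℕ → ℕ) → ℕ
sumFrom lo zero f = 0
sumFrom lo (suc n) f = f lo + sumFrom (suc lo) n f

<suc+⇒<+suc : ∀ {i} lo n → i < suc lo + n → i < lo + suc n
<suc+⇒<+suc {i} lo n = subst (i <_) (sym (+-suc lo n))

<+suc⇒<suc+ : ∀ {i} lo n → i < lo + suc n → i < suc lo + n
<+suc⇒<suc+ {i} lo n = subst (i <_) (+-suc lo n)

sumFrom-cong : ∀ lo n {f g : ℕ → ℕ} → (∀ i → lo ≤ i → i < lo + n → f i ≡ g i) →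
  sumFrom lo n f ≡ sumFrom lo n g
sumFrom-cong lo zero h = refl
sumFrom-cong lo (suc n) h = cong₂ _+_ (h lo ≤-refl (m<m+n lo (s≤s z≤n)))
  (sumFrom-cong (suc lo) n (λ i l i< → h i (<⇒≤ l) (<suc+⇒<+suc lo n i<)))

sumFrom-mono-≤ : ∀ lo n {f g : ℕ → ℕ} → (∀ i → lo ≤ i → i < lo + n → f i ≤ g i) →
  sumFrom lo n f ≤ sumFrom lo n g
sumFrom-mono-≤ lo zero h = z≤n
sumFrom-mono-≤ lo (suc n) h = +-mono-≤ (h lo ≤-refl (m<m+n lo (s≤s z≤n)))
  (sumFrom-mono-≤ (suc lo) n (λ i l i< → h i (<⇒≤ l) (<suc+⇒<+suc lo n i<)))

sumFrom-zero : ∀ lo n (f : ℕ → ℕ) → (∀ i → lo ≤ i → i < lo + n → f i ≡ 0) → sumFrom lo n f ≡ 0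
sumFrom-zero lo zero f h = refl
sumFrom-zero lo (suc n) f h rewrite h lo ≤-refl (m<m+n lo (s≤s z≤n)) =
  sumFrom-zero (suc lo) n f (λ i l i< → h i (<⇒≤ l) (<suc+⇒<+suc lo n i<))

sumFrom-ones : ∀ lo n → sumFrom lo n (λ _ → 1) ≡ n
sumFrom-ones lo zero = refl
sumFrom-ones lo (suc n) = cong suc (sumFrom-ones (suc lo) n)

sumFrom-+ : ∀ lo n (f g : ℕ → ℕ) → sumFrom lo n (λ i → f i + g i) ≡ sumFrom lo n f + sumFrom lo n g
sumFrom-+ lo zero f g = refl
sumFrom-+ lo (suc n) f g rewrite sumFrom-+ (suc lo) n f g =
  interchange (f lo) (g lo) (sumFrom (suc lo) n f) (sumFrom (suc lo) n g)

sumFrom-split : ∀ lo a b (f : ℕ → ℕ) → sumFrom lo (a + b) f ≡ sumFrom lo a f + sumFrom (lo + a) b f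
sumFrom-split lo zero b f rewrite +-identityʳ lo = refl
sumFrom-split lo (suc a) b f rewrite sumFrom-split (suc lo) a b f | +-suc lo a = sym (+-assoc (f lo) _ _)

sumFrom-swap : ∀ a n b m (f : ℕ → ℕ → ℕ) →
  sumFrom a n (λ i → sumFrom b m (f i)) ≡ sumFrom b m (λ j → sumFrom a n (λ i → f i j))
sumFrom-swap a zero b m f = sym (sumFrom-zero b m (λ _ → 0) (λ _ _ _ → refl))
sumFrom-swap a (suc n) b m f =
  trans (cong (sumFrom b m (f a) +_) (sumFrom-swap (suc a) n b m f))
        (sym (sumFrom-+ b m (f a) (λ j → sumFrom (suc a) n (λ i → f i j))))

sumFrom-suc : ∀ lo n (f : ℕ → ℕ) → sumFrom (suc lo) n f ≡ sumFrom lo n (λ i → f (suc i))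
sumFrom-suc lo zero f = refl
sumFrom-suc lo (suc n) f = cong (f (suc lo) +_) (sumFrom-suc (suc lo) n f)

term≤sumFrom : ∀ lo n (f : ℕ → ℕ) i → lo ≤ i → i < lo + n → f i ≤ sumFrom lo n f
term≤sumFrom lo zero f i l u = ⊥-elim (<⇒≱ u (subst (_≤ i) (sym (+-identityʳ lo)) l))
term≤sumFrom lo (suc n) f i l u with lo ≟ i
... | yes refl = m≤m+n (f lo) _
... | no ne = ≤-trans (term≤sumFrom (suc lo) n f i (≤∧≢⇒< l ne) (<+suc⇒<suc+ lo n u)) (m≤n+m _ (f lo))

twoTerms≤sumFrom : ∀ lo n (f : ℕ → ℕ) i j → i ≢ j → lo ≤ i → i < lo + n → lo ≤ j → j < lo + n →
  f i + f j ≤ sumFrom lo n f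
twoTerms≤sumFrom lo zero f i j _ l u _ _ = ⊥-elim (<⇒≱ u (subst (_≤ i) (sym (+-identityʳ lo)) l))
twoTerms≤sumFrom lo (suc n) f i j ne li ui lj uj with lo ≟ i | lo ≟ j
... | yes refl | yes refl = ⊥-elim (ne refl)
... | yes refl | no nj =
  +-monoʳ-≤ (f lo) (term≤sumFrom (suc lo) n f j (≤∧≢⇒< lj nj) (<+suc⇒<suc+ lo n uj))
... | no ni | yes refl = subst (_≤ f lo + sumFrom (suc lo) n f) (+-comm (f lo) (f i))
  (+-monoʳ-≤ (f lo) (term≤sumFrom (suc lo) n f i (≤∧≢⇒< li ni) (<+suc⇒<suc+ lo n ui)))
... | no ni | no nj = ≤-trans
  (twoTerms≤sumFrom (suc lo) n f i j ne (≤∧≢⇒< li ni) (<+suc⇒<suc+ lo n ui) (≤∧≢⇒< lj nj) (<+suc⇒<suc+ lo n uj))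
  (m≤n+m _ (f lo))

sumFrom-positive : ∀ lo n (f : ℕ → ℕ) → 1 ≤ sumFrom lo n f → ∃[ i ] (lo ≤ i × i < lo + n × 1 ≤ f i)
sumFrom-positive lo (suc n) f h with f lo ≟ 0
... | no nz = lo , ≤-refl , m<m+n lo (s≤s z≤n) , n≢0⇒n>0 nz
... | yes z rewrite z with sumFrom-positive (suc lo) n f h
... | i , l , u , fi = i , <⇒≤ l , <suc+⇒<+suc lo n u , fi

sumFrom-tight : ∀ lo n (f g : ℕ → ℕ) → (∀ i → lo ≤ i → i < lo + n → f i ≤ g i) →
  sumFrom lo n g ≤ sumFrom lo n f → ∀ i → lo ≤ i → i < lo + n → f i ≡ g i
sumFrom-tight lo zero f g h e i l u = ⊥-elim (<⇒≱ u (subst (_≤ i) (sym (+-identityʳ lo)) l))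
sumFrom-tight lo (suc n) f g h e i l u with lo ≟ i
... | yes refl = head-tight
  where
  head-tight : f lo ≡ g lo
  head-tight = ≤-antisym (h lo ≤-refl (m<m+n lo (s≤s z≤n)))
    (+-cancelʳ-≤ _ _ _ (≤-trans (+-monoʳ-≤ (g lo) (sumFrom-mono-≤ (suc lo) n tail-≤)) e))
    where
    tail-≤ : ∀ i → suc lo ≤ i → i < suc lo + n → f i ≤ g i
    tail-≤ i l i< = h i (<⇒≤ l) (<suc+⇒<+suc lo n i<)
... | no ne = sumFrom-tight (suc lo) n f g (λ i l i< → h i (<⇒≤ l) (<suc+⇒<+suc lo n i<))
  (+-cancelˡ-≤ (f lo) _ _ (≤-trans (+-monoˡ-≤ _ (h lo ≤-refl (m<m+n lo (s≤s z≤n)))) e))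
  i (≤∧≢⇒< l ne) (<+suc⇒<suc+ lo n u)

𝟙 : Bool → ℕ
𝟙 true = 1
𝟙 false = 0

𝟙≤1 : ∀ b → 𝟙 b ≤ 1
𝟙≤1 true = ≤-refl
𝟙≤1 false = z≤n

𝟙-≡ᵇ-≡ : ∀ {m n} → m ≡ n → 𝟙 (m ≡ᵇ n) ≡ 1
𝟙-≡ᵇ-≡ {m} {n} e rewrite T⇒≡true (≡⇒≡ᵇ m n e) = refl

𝟙-≡ᵇ-≢ : ∀ {m n} → m ≢ n → 𝟙 (m ≡ᵇ n) ≡ 0
𝟙-≡ᵇ-≢ {m} {n} ne rewrite ¬T⇒≡false (λ t → ne (≡ᵇ⇒≡ m n t)) = refl

𝟙≡1⇒T : ∀ {b} → 𝟙 b ≡ 1 → T b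
𝟙≡1⇒T {true} _ = tt

1≤𝟙⇒T : ∀ {b} → 1 ≤ 𝟙 b → T b
1≤𝟙⇒T {true} _ = tt

𝟙-0⊎1 : ∀ b → 𝟙 b ≡ 0 ⊎ 𝟙 b ≡ 1
𝟙-0⊎1 true = inj₂ refl
𝟙-0⊎1 false = inj₁ refl

sumFrom-𝟙-≡ᵇ≤1 : ∀ lo n x → sumFrom lo n (λ i → 𝟙 (x ≡ᵇ i)) ≤ 1
sumFrom-𝟙-≡ᵇ≤1 lo zero x = z≤n
sumFrom-𝟙-≡ᵇ≤1 lo (suc n) x with x ≟ lo
... | yes refl rewrite 𝟙-≡ᵇ-≡ {x} refl
                     | sumFrom-zero (suc x) n (λ i → 𝟙 (x ≡ᵇ i)) (λ i l _ → 𝟙-≡ᵇ-≢ (<⇒≢ l)) = ≤-refl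
... | no ne rewrite 𝟙-≡ᵇ-≢ ne = sumFrom-𝟙-≡ᵇ≤1 (suc lo) n x

sumFrom-delta : ∀ lo n (f : ℕ → ℕ) v → lo ≤ v → v < lo + n → sumFrom lo n (λ i → f i * 𝟙 (v ≡ᵇ i)) ≡ f v
sumFrom-delta lo zero f v l u = ⊥-elim (<⇒≱ u (subst (_≤ v) (sym (+-identityʳ lo)) l))
sumFrom-delta lo (suc n) f v l u with v ≟ lo
... | yes refl rewrite 𝟙-≡ᵇ-≡ {v} refl | *-identityʳ (f v)
                     | sumFrom-zero (suc v) n (λ i → f i * 𝟙 (v ≡ᵇ i))
                         (λ i li _ → trans (cong (f i *_) (𝟙-≡ᵇ-≢ (<⇒≢ li))) (*-zeroʳ (f i))) = +-identityʳ (f v)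
... | no ne rewrite 𝟙-≡ᵇ-≢ ne | *-zeroʳ (f lo) =
  sumFrom-delta (suc lo) n f v (≤∧≢⇒< l (λ e → ne (sym e))) (<+suc⇒<suc+ lo n u)

sumFrom-≤1 : ∀ lo n (f : ℕ → ℕ) → (∀ i → f i ≤ 1) →
  (∀ i j → lo ≤ i → i < j → j < lo + n → f i ≡ 1 → f j ≡ 0) → sumFrom lo n f ≤ 1
sumFrom-≤1 lo zero f b1 ex = z≤n
sumFrom-≤1 lo (suc n) f b1 ex with m≤n⇒m<n∨m≡n (b1 lo)
... | inj₁ f<1 rewrite n<1⇒n≡0 f<1 =
  sumFrom-≤1 (suc lo) n f b1 (λ i j l i<j j< → ex i j (<⇒≤ l) i<j (<suc+⇒<+suc lo n j<))
... | inj₂ f≡1 rewrite f≡1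
                     | sumFrom-zero (suc lo) n f (λ j l j< → ex lo j ≤-refl l (<suc+⇒<+suc lo n j<) f≡1) = ≤-refl

countOcc-∷ : ∀ v x xs → countOcc v (x ∷ xs) ≡ 𝟙 (v ≡ᵇ x) + countOcc v xs
countOcc-∷ v x xs with v ≡ᵇ x
... | true = refl
... | false = refl

countOcc-++ : ∀ v xs ys → countOcc v (xs ++ ys) ≡ countOcc v xs + countOcc v ys
countOcc-++ v [] ys = refl
countOcc-++ v (x ∷ xs) ys rewrite countOcc-∷ v x (xs ++ ys) | countOcc-∷ v x xs | countOcc-++ v xs ys =
  sym (+-assoc (𝟙 (v ≡ᵇ x)) _ _)

countOcc-replicate : ∀ v a x → countOcc v (replicate a x) ≡ a * 𝟙 (v ≡ᵇ x)
countOcc-replicate v zero x = refl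
countOcc-replicate v (suc a) x = trans (countOcc-∷ v x (replicate a x)) (cong (𝟙 (v ≡ᵇ x) +_) (countOcc-replicate v a x))

countOcc-get0 : ∀ v r → countOcc v r ≡ sumFrom 1 (length r) (λ k → 𝟙 (v ≡ᵇ get0 r k))
countOcc-get0 v [] = refl
countOcc-get0 v (x ∷ xs) rewrite countOcc-∷ v x xs = cong (𝟙 (v ≡ᵇ x) +_) (begin
  countOcc v xs                                                  ≡⟨ countOcc-get0 v xs ⟩
  sumFrom 1 (length xs) (λ k → 𝟙 (v ≡ᵇ get0 xs k))                ≡⟨ sumFrom-cong 1 (length xs) (λ { (suc i) _ _ → refl }) ⟩
  sumFrom 1 (length xs) (λ k → 𝟙 (v ≡ᵇ get0 (x ∷ xs) (suc k)))    ≡⟨ sumFrom-suc 1 (length xs) _ ⟨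
  sumFrom 2 (length xs) (λ k → 𝟙 (v ≡ᵇ get0 (x ∷ xs) k))          ∎)
  where open ≡-Reasoning

countOcc-concat : ∀ v (t : List (List ℕ)) → countOcc v (concat t) ≡ sumFrom 1 (length t) (λ p → countOcc v (rowOf t p))
countOcc-concat v [] = refl
countOcc-concat v (r ∷ rs) rewrite countOcc-++ v r (concat rs) = cong (countOcc v r +_) (begin
  countOcc v (concat rs)                                         ≡⟨ countOcc-concat v rs ⟩
  sumFrom 1 (length rs) (λ p → countOcc v (rowOf rs p))          ≡⟨ sumFrom-cong 1 (length rs) (λ { (suc i) _ _ → refl }) ⟩
  sumFrom 1 (length rs) (λ p → countOcc v (rowOf (r ∷ rs) (suc p))) ≡⟨ sumFrom-suc 1 (length rs) _ ⟨
  sumFrom 2 (length rs) (λ p → countOcc v (rowOf (r ∷ rs) p))    ∎)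
  where open ≡-Reasoning

-- Excess over a threshold

excess : ℕ → List ℕ → ℕ
excess m xs = sum (map (_∸ m) xs)

excess-get0 : ∀ m xs → excess m xs ≡ sumFrom 1 (length xs) (λ v → get0 xs v ∸ m)
excess-get0 m [] = refl
excess-get0 m (x ∷ xs) = cong ((x ∸ m) +_) (trans (excess-get0 m xs)
  (trans (sumFrom-cong 1 (length xs) (λ { (suc i) _ _ → refl }))
         (sym (sumFrom-suc 1 (length xs) (λ v → get0 (x ∷ xs) v ∸ m)))))

excess-delZeros : ∀ m xs → excess m (delZeros xs) ≡ excess m xs
excess-delZeros m [] = refl
excess-delZeros m (zero ∷ xs) = trans (excess-delZeros m xs) (cong (_+ excess m xs) (sym (0∸n≡0 m)))
excess-delZeros m (suc x ∷ xs) = cong (suc x ∸ m +_) (excess-delZeros m xs)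

excess-insertDec : ∀ m x xs → excess m (insertDec x xs) ≡ (x ∸ m) + excess m xs
excess-insertDec m x [] = refl
excess-insertDec m x (y ∷ ys) with y ≤ᵇ x
... | true = refl
... | false = trans (cong ((y ∸ m) +_) (excess-insertDec m x ys)) (x+[y+z]≡y+[x+z] (y ∸ m) (x ∸ m) _)
  where
  x+[y+z]≡y+[x+z] : ∀ a b c → a + (b + c) ≡ b + (a + c)
  x+[y+z]≡y+[x+z] a b c = trans (sym (+-assoc a b c)) (trans (cong (_+ c) (+-comm a b)) (+-assoc b a c))

excess-sortDec : ∀ m xs → excess m (sortDec xs) ≡ excess m xs
excess-sortDec m [] = refl
excess-sortDec m (x ∷ xs) = trans (excess-insertDec m x (sortDec xs)) (cong ((x ∸ m) +_) (excess-sortDec m xs))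

excess-partitionOf : ∀ m xs → excess m (partitionOf xs) ≡ excess m xs
excess-partitionOf m xs = trans (excess-sortDec m (delZeros xs)) (excess-delZeros m xs)

insertDec-All : ∀ {b} x xs → x ≤ b → All (_≤ b) xs → All (_≤ b) (insertDec x xs)
insertDec-All x [] xb [] = xb ∷ []
insertDec-All x (y ∷ ys) xb (yb ∷ h) with y ≤ᵇ x
... | true = xb ∷ yb ∷ h
... | false = yb ∷ insertDec-All x ys xb h

insertDec-decreasing : ∀ x xs → AllPairs _≥_ xs → AllPairs _≥_ (insertDec x xs)
insertDec-decreasing x [] _ = [] ∷ []
insertDec-decreasing x (y ∷ ys) (Ay ∷ Sy) with y ≤ᵇ x in eq
... | true = (y≤x ∷ All.map (λ z≤y → ≤-trans z≤y y≤x) Ay) ∷ Ay ∷ Sy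
  where
  y≤x : y ≤ x
  y≤x = ≤ᵇ⇒≤ y x (subst T (sym eq) tt)
... | false = insertDec-All x ys (<⇒≤ (≰⇒> (λ y≤x → subst T eq (≤⇒≤ᵇ y≤x)))) Ay ∷ insertDec-decreasing x ys Sy

partitionOf-decreasing : ∀ xs → AllPairs _≥_ (partitionOf xs)
partitionOf-decreasing xs = sortDec-decreasing (delZeros xs)
  where
  sortDec-decreasing : ∀ xs → AllPairs _≥_ (sortDec xs)
  sortDec-decreasing [] = []
  sortDec-decreasing (x ∷ xs) = insertDec-decreasing x (sortDec xs) (sortDec-decreasing xs)

excess-bounded : ∀ m b xs → b ≤ m → All (_≤ b) xs → excess m xs ≡ 0
excess-bounded m b [] _ [] = refl
excess-bounded m b (x ∷ xs) bm (h ∷ hs) rewrite m≤n⇒m∸n≡0 (≤-trans h bm) = excess-bounded m b xs bm hs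

-- At the first difference a > b of the two lists, the threshold a − 1 separates them.
>lex⇒excess< : ∀ μ ν → AllPairs _≥_ μ → AllPairs _≥_ ν → μ >lex ν → ∃[ m ] (excess m ν < excess m μ)
>lex⇒excess< (a ∷ μ) (b ∷ ν) _ (Aν ∷ _) (inj₁ b<a) = pred a , excess-ν<excess-μ
  where
  b≤pred-a : b ≤ pred a
  b≤pred-a = pred-mono-≤ b<a
  a∸pred-a≡1 : ∀ a → 1 ≤ a → a ∸ pred a ≡ 1
  a∸pred-a≡1 (suc a) _ = trans (+-∸-assoc 1 {a} {a} ≤-refl) (cong suc (n∸n≡0 a))
  excess-ν<excess-μ : excess (pred a) (b ∷ ν) < excess (pred a) (a ∷ μ)
  excess-ν<excess-μ rewrite m≤n⇒m∸n≡0 b≤pred-a | excess-bounded (pred a) b ν b≤pred-a Aν =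
    ≤-trans (≤-reflexive (sym (a∸pred-a≡1 a (≤-trans (s≤s z≤n) b<a)))) (m≤m+n (a ∸ pred a) _)
>lex⇒excess< (a ∷ μ) (b ∷ ν) (_ ∷ Sμ) (_ ∷ Sν) (inj₂ (refl , r)) with >lex⇒excess< μ ν Sμ Sν r
... | m , h = m , +-monoʳ-< (a ∸ m) h

length-partitionOf : ∀ xs → All (0 <_) xs → length (partitionOf xs) ≡ length xs
length-partitionOf xs h = trans (length-sortDec (delZeros xs)) (cong length (delZeros-positive xs h))
  where
  length-insertDec : ∀ x xs → length (insertDec x xs) ≡ suc (length xs)
  length-insertDec x [] = refl
  length-insertDec x (y ∷ ys) with y ≤ᵇ x
  ... | true = refl
  ... | false = cong suc (length-insertDec x ys)
  length-sortDec : ∀ xs → length (sortDec xs) ≡ length xs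
  length-sortDec [] = refl
  length-sortDec (x ∷ xs) = trans (length-insertDec x (sortDec xs)) (cong suc (length-sortDec xs))
  delZeros-positive : ∀ xs → All (0 <_) xs → delZeros xs ≡ xs
  delZeros-positive [] [] = refl
  delZeros-positive (suc x ∷ xs) (_ ∷ h) = cong (suc x ∷_) (delZeros-positive xs h)

>lex-firstDifference : ∀ β α → β >lex α → ∃[ p ] (1 ≤ p × p ≤ length α ×
  (∀ v → 1 ≤ v → v < p → get0 β v ≡ get0 α v) × get0 α p < get0 β p)
>lex-firstDifference (b ∷ bs) (a ∷ as) (inj₁ a<b) =
  1 , ≤-refl , s≤s z≤n , (λ { v lv (s≤s v<1) → ⊥-elim (<⇒≱ lv v<1) }) , a<b
>lex-firstDifference (b ∷ bs) (a ∷ as) (inj₂ (refl , r)) with >lex-firstDifference bs as r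
... | suc p , _ , p≤ , agree , differ = suc (suc p) , s≤s z≤n , s≤s p≤ , agree′ , differ
  where
  agree′ : ∀ v → 1 ≤ v → v < suc (suc p) → get0 (b ∷ bs) v ≡ get0 (b ∷ as) v
  agree′ (suc zero) _ _ = refl
  agree′ (suc (suc v)) _ (s≤s v<p) = agree (suc v) (s≤s z≤n) v<p

entry : List (List ℕ) → ℕ → ℕ → ℕ
entry t i k = get0 (rowOf t i) k

record IsComT (α : List ℕ) (t : List (List ℕ)) : Set where
  field
    length≡ : length t ≡ length α
    rowLength : ∀ i → 1 ≤ i → i ≤ length α → length (rowOf t i) ≡ get0 α i
    positive : ∀ i k → 1 ≤ i → i ≤ length α → 1 ≤ k → k ≤ get0 α i → 1 ≤ entry t i k
    rowDecreasing : ∀ i k → 1 ≤ i → i ≤ length α → 2 ≤ k → k ≤ get0 α i → entry t i k ≤ entry t i (k ∸ 1)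
    firstColumnIncreasing : ∀ i → 1 ≤ i → i ≤ length α ∸ 1 → entry t i 1 < entry t (suc i) 1
    triple : ∀ i j k → 1 ≤ i → i ≤ length α → 1 ≤ j → j ≤ length α → 2 ≤ k → k ≤ maxL α → i < j →
      entry t j k ≢ 0 → entry t i k ≤ entry t j k → entry t i (k ∸ 1) < entry t j k

module _ (α : List ℕ) (t : List (List ℕ)) where

  private
    ℓ : ℕ
    ℓ = length α
    lengthOK rowsOK decreasingOK columnOK tripleOK : Bool
    lengthOK = length t ≡ᵇ ℓ
    rowsOK = allIn 1 ℓ (λ i → (length (rowOf t i) ≡ᵇ get0 α i) ∧ all (λ x → 1 ≤ᵇ x) (rowOf t i))
    decreasingOK = allIn 1 ℓ (λ i → allIn 2 (get0 α i) (λ k → entry t i k ≤ᵇ entry t i (k ∸ 1)))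
    columnOK = allIn 1 (ℓ ∸ 1) (λ i → entry t i 1 <ᵇ entry t (suc i) 1)
    tripleOK = allIn 1 ℓ (λ i → allIn 1 ℓ (λ j → allIn 2 (maxL α) (λ k →
      ((i <ᵇ j) ∧ not (entry t j k ≡ᵇ 0) ∧ (entry t i k ≤ᵇ entry t j k)) ⇒ᵇ (entry t i (k ∸ 1) <ᵇ entry t j k))))

  isComT⇒IsComT : T (isComT α t) → IsComT α t
  isComT⇒IsComT h = record
    { length≡ = ≡ᵇ⇒≡ _ _ (∧-fst {lengthOK} h)
    ; rowLength = rowLength
    ; positive = λ i k li iℓ lk ka → ≤ᵇ⇒≤ _ _ (all-get0 (rowOf t i) (∧-snd (row i li iℓ)) k lk
        (subst (k ≤_) (sym (rowLength i li iℓ)) ka))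
    ; rowDecreasing = λ i k li iℓ lk ka → ≤ᵇ⇒≤ _ _ (allIn-elim (allIn-elim hDecreasing i li iℓ) k lk ka)
    ; firstColumnIncreasing = λ i li iℓ → <ᵇ⇒< _ _ (allIn-elim hColumn i li iℓ)
    ; triple = λ i j k li iℓ lj jℓ lk km i<j nz le → <ᵇ⇒< _ _ (⇒ᵇ-elim
        (allIn-elim (allIn-elim (allIn-elim hTriple i li iℓ) j lj jℓ) k lk km)
        (∧-intro (<⇒<ᵇ i<j) (∧-intro (≢⇒T-not-≡ᵇ nz) (≤⇒≤ᵇ le))))
    }
    where
    hRows : T rowsOK
    hRows = ∧-fst {rowsOK} (∧-snd {lengthOK} h)
    hDecreasing : T decreasingOK
    hDecreasing = ∧-fst {decreasingOK} (∧-snd {rowsOK} (∧-snd {lengthOK} h))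
    hColumn : T columnOK
    hColumn = ∧-fst {columnOK} (∧-snd {decreasingOK} (∧-snd {rowsOK} (∧-snd {lengthOK} h)))
    hTriple : T tripleOK
    hTriple = ∧-snd {columnOK} (∧-snd {decreasingOK} (∧-snd {rowsOK} (∧-snd {lengthOK} h)))
    row : ∀ i → 1 ≤ i → i ≤ ℓ → T ((length (rowOf t i) ≡ᵇ get0 α i) ∧ all (λ x → 1 ≤ᵇ x) (rowOf t i))
    row = allIn-elim hRows
    rowLength : ∀ i → 1 ≤ i → i ≤ ℓ → length (rowOf t i) ≡ get0 α i
    rowLength i li iℓ = ≡ᵇ⇒≡ _ _ (∧-fst {length (rowOf t i) ≡ᵇ get0 α i} (row i li iℓ))

  IsComT⇒isComT : IsComT α t → T (isComT α t)
  IsComT⇒isComT c = ∧-intro (≡⇒≡ᵇ _ _ length≡) (∧-intro hRows (∧-intro hDecreasing (∧-intro hColumn hTriple)))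
    where
    open IsComT c
    hRows : T rowsOK
    hRows = allIn-intro (λ i li iℓ → ∧-intro (≡⇒≡ᵇ _ _ (rowLength i li iℓ)) (get0-all (rowOf t i) (λ k lk kl →
      ≤⇒≤ᵇ (positive i k li iℓ lk (subst (k ≤_) (rowLength i li iℓ) kl)))))
    hDecreasing : T decreasingOK
    hDecreasing = allIn-intro (λ i li iℓ → allIn-intro (λ k lk ka → ≤⇒≤ᵇ (rowDecreasing i k li iℓ lk ka)))
    hColumn : T columnOK
    hColumn = allIn-intro (λ i li iℓ → <⇒<ᵇ (firstColumnIncreasing i li iℓ))
    hTriple : T tripleOK
    hTriple = allIn-intro (λ i li iℓ → allIn-intro (λ j lj jℓ → allIn-intro (λ k lk km → ⇒ᵇ-intro (λ hyp →
      <⇒<ᵇ (triple i j k li iℓ lj jℓ lk km (<ᵇ⇒< _ _ (∧-fst hyp)) (T-not-≡ᵇ⇒≢ (∧-fst (∧-snd {i <ᵇ j} hyp)))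
        (≤ᵇ⇒≤ _ _ (∧-snd (∧-snd {i <ᵇ j} hyp))))))))

record HasWeight (β : List ℕ) (xs : List ℕ) : Set where
  field
    bounded : T (all (λ x → x ≤ᵇ length β) xs)
    count : ∀ v → 1 ≤ v → v ≤ length β → countOcc v xs ≡ get0 β v

weightOK⇒HasWeight : ∀ β xs → T (weightOK β xs) → HasWeight β xs
weightOK⇒HasWeight β xs h = record
  { bounded = ∧-fst {all (λ x → x ≤ᵇ length β) xs} h
  ; count = λ v lv vL → ≡ᵇ⇒≡ _ _ (allIn-elim (∧-snd {all (λ x → x ≤ᵇ length β) xs} h) v lv vL)
  }

HasWeight⇒weightOK : ∀ β xs → HasWeight β xs → T (weightOK β xs)
HasWeight⇒weightOK β xs w = ∧-intro (HasWeight.bounded w) (allIn-intro (λ v lv vL → ≡⇒≡ᵇ _ _ (HasWeight.count w v lv vL)))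

-- Counting the entries of a ComT by columns

module ComTCounting (α β : List ℕ) (t : List (List ℕ)) (c : IsComT α t) (w : HasWeight β (concat t)) where

  open IsComT c

  private
    ℓ : ℕ
    ℓ = length α
    a : ℕ → ℕ
    a = get0 α
    E : ℕ → ℕ → ℕ
    E = entry t
    L : ℕ
    L = length β
    b : ℕ → ℕ
    b = get0 β
    W : ℕ
    W = suc (maxL α)

  entry-beyondRow : ∀ i k → a i < k → E i k ≡ 0
  entry-beyondRow zero k _ rewrite rowOf-zero t = refl
  entry-beyondRow (suc i) k ak with suc i ≤? ℓ
  ... | yes q = get0-outOfRange (rowOf t (suc i)) k (subst (_< k) (sym (rowLength (suc i) (s≤s z≤n) q)) ak)
  ... | no q rewrite rowOf-outOfRange t (suc i) (subst (_< suc i) (sym length≡) (≰⇒> q)) = refl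

  nonzero⇒inRow : ∀ i k → E i k ≢ 0 → k ≤ a i
  nonzero⇒inRow i k nz with k ≤? a i
  ... | yes q = q
  ... | no q = ⊥-elim (nz (entry-beyondRow i k (≰⇒> q)))

  triple-anyColumn : ∀ i j k → 1 ≤ i → i < j → j ≤ ℓ → 2 ≤ k → E j k ≢ 0 → E i k ≤ E j k → E i (k ∸ 1) < E j k
  triple-anyColumn i j k li i<j jℓ lk nz le =
    triple i j k li (≤-trans (<⇒≤ i<j) jℓ) (≤-trans li (<⇒≤ i<j)) jℓ lk
      (≤-trans (nonzero⇒inRow j k nz) (get0≤maxL α j)) i<j nz le

  firstColumn-< : ∀ i j → 1 ≤ i → i < j → j ≤ ℓ → E i 1 < E j 1
  firstColumn-< i (suc j) li (s≤s i≤j) j≤ with i ≟ j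
  ... | yes refl = firstColumnIncreasing i li (∸-monoˡ-≤ 1 j≤)
  ... | no ne = <-trans (firstColumn-< i j li (≤∧≢⇒< i≤j ne) (<⇒≤ j≤))
                        (firstColumnIncreasing j (≤-trans li i≤j) (∸-monoˡ-≤ 1 j≤))

  entry≤firstEntry : ∀ s k → 1 ≤ s → s ≤ ℓ → 1 ≤ k → k ≤ a s → E s k ≤ E s 1
  entry≤firstEntry s (suc zero) _ _ _ _ = ≤-refl
  entry≤firstEntry s (suc (suc k)) ls sℓ _ ks =
    ≤-trans (rowDecreasing s (suc (suc k)) ls sℓ (s≤s (s≤s z≤n)) ks) (entry≤firstEntry s (suc k) ls sℓ (s≤s z≤n) (<⇒≤ ks))

  -- Below row i, an equal entry in column k + 2 would exceed E i (k + 1) ≥ E i (k + 2) by the triple condition.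
  column-distinct : ∀ i j k → 1 ≤ i → i < j → j ≤ ℓ → 1 ≤ k → k ≤ a j → E i k ≢ E j k
  column-distinct i j (suc zero) li i<j j≤ _ _ e = <⇒≢ (firstColumn-< i j li i<j j≤) e
  column-distinct i j (suc (suc k)) li i<j j≤ _ kj e =
    <-irrefl refl (≤-trans (s≤s (subst (_≤ E i (suc k)) e decreasing)) (triple-anyColumn i j (suc (suc k)) li i<j j≤ (s≤s (s≤s z≤n)) nz (≤-reflexive e)))
    where
    nz : E j (suc (suc k)) ≢ 0
    nz z = <⇒≢ (positive j (suc (suc k)) (≤-trans li (<⇒≤ i<j)) j≤ (s≤s z≤n) kj) (sym z)
    decreasing : E i (suc (suc k)) ≤ E i (suc k)
    decreasing = rowDecreasing i (suc (suc k)) li (≤-trans (<⇒≤ i<j) j≤) (s≤s (s≤s z≤n))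
      (nonzero⇒inRow i (suc (suc k)) (λ z → nz (trans (sym e) z)))

  occ : ℕ → ℕ → ℕ → ℕ
  occ v i k = 𝟙 (v ≡ᵇ E i k)

  column-occurrences≤1 : ∀ k v → 1 ≤ v → 1 ≤ k → sumFrom 1 ℓ (λ i → occ v i k) ≤ 1
  column-occurrences≤1 k v lv lk = sumFrom-≤1 1 ℓ (λ i → occ v i k) (λ i → 𝟙≤1 _) onlyOne
    where
    onlyOne : ∀ i j → 1 ≤ i → i < j → j < 1 + ℓ → occ v i k ≡ 1 → occ v j k ≡ 0
    onlyOne i j li i<j j< vi with 𝟙-0⊎1 (v ≡ᵇ E j k)
    ... | inj₁ z = z
    ... | inj₂ vj = ⊥-elim (column-distinct i j k li i<j (≤-pred j<) lk
                      (nonzero⇒inRow j k (λ z → <⇒≢ lv (sym (trans v≡Ej z)))) (trans (sym v≡Ei) v≡Ej))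
      where
      v≡Ei : v ≡ E i k
      v≡Ei = ≡ᵇ⇒≡ _ _ (𝟙≡1⇒T vi)
      v≡Ej : v ≡ E j k
      v≡Ej = ≡ᵇ⇒≡ _ _ (𝟙≡1⇒T vj)

  cell-occurrences≤1 : ∀ i k → 1 ≤ k → sumFrom 1 L (λ v → occ v i k) ≤ 𝟙 (k ≤ᵇ a i)
  cell-occurrences≤1 i k lk with k ≤? a i
  ... | yes q rewrite T⇒≡true (≤⇒≤ᵇ q) =
    subst (_≤ 1) (sym (sumFrom-cong 1 L (λ v _ _ → cong 𝟙 (≡ᵇ-sym v (E i k))))) (sumFrom-𝟙-≡ᵇ≤1 1 L (E i k))
  ... | no q rewrite ¬T⇒≡false (λ t → q (≤ᵇ⇒≤ _ _ t)) | entry-beyondRow i k (≰⇒> q) =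
    ≤-reflexive (sumFrom-zero 1 L (λ v → 𝟙 (v ≡ᵇ 0)) (λ { (suc v) _ _ → refl }))

  occurrences : ℕ → ℕ
  occurrences v = sumFrom 1 ℓ (λ i → sumFrom 1 W (occ v i))

  occurrencesUpTo occurrencesBeyond : ℕ → ℕ → ℕ
  occurrencesUpTo m v = sumFrom 1 ℓ (λ i → sumFrom 1 m (occ v i))
  occurrencesBeyond m v = sumFrom 1 ℓ (λ i → sumFrom (suc m) (W ∸ m) (occ v i))

  occurrencesInRows≡weight : ∀ v → 1 ≤ v → v ≤ L → sumFrom 1 ℓ (λ i → sumFrom 1 (a i) (occ v i)) ≡ b v
  occurrencesInRows≡weight v lv vL = begin
    sumFrom 1 ℓ (λ i → sumFrom 1 (a i) (occ v i))               ≡⟨ sumFrom-cong 1 ℓ (λ i li i< → rowOccurrences i li (≤-pred i<)) ⟨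
    sumFrom 1 ℓ (λ i → countOcc v (rowOf t i))                  ≡⟨ cong (λ n → sumFrom 1 n (λ i → countOcc v (rowOf t i))) length≡ ⟨
    sumFrom 1 (length t) (λ i → countOcc v (rowOf t i))         ≡⟨ countOcc-concat v t ⟨
    countOcc v (concat t)                                       ≡⟨ HasWeight.count w v lv vL ⟩
    b v                                                         ∎
    where
    open ≡-Reasoning
    rowOccurrences : ∀ i → 1 ≤ i → i ≤ ℓ → countOcc v (rowOf t i) ≡ sumFrom 1 (a i) (occ v i)
    rowOccurrences i li iℓ = trans (countOcc-get0 v (rowOf t i))
      (cong (λ n → sumFrom 1 n (λ k → 𝟙 (v ≡ᵇ E i k))) (rowLength i li iℓ))

  occurrences≡weight : ∀ v → 1 ≤ v → v ≤ L → occurrences v ≡ b v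
  occurrences≡weight v lv vL =
    trans (sym (sumFrom-cong 1 ℓ (λ i li i< → rowOccurrences-extend i))) (occurrencesInRows≡weight v lv vL)
    where
    open ≡-Reasoning
    rowOccurrences-extend : ∀ i → sumFrom 1 (a i) (occ v i) ≡ sumFrom 1 W (occ v i)
    rowOccurrences-extend i = begin
      sumFrom 1 (a i) (occ v i)                                  ≡⟨ +-identityʳ _ ⟨
      sumFrom 1 (a i) (occ v i) + 0                              ≡⟨ cong (sumFrom 1 (a i) (occ v i) +_) (sumFrom-zero (suc (a i)) (W ∸ a i) (occ v i)
                                                                      (λ k l _ → 𝟙-≡ᵇ-≢ (λ e → <⇒≢ lv (sym (trans e (entry-beyondRow i k l)))))) ⟨
      sumFrom 1 (a i) (occ v i) + sumFrom (suc (a i)) (W ∸ a i) (occ v i) ≡⟨ sumFrom-split 1 (a i) (W ∸ a i) (occ v i) ⟨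
      sumFrom 1 (a i + (W ∸ a i)) (occ v i)                      ≡⟨ cong (λ n → sumFrom 1 n (occ v i)) (m+[n∸m]≡n (≤-trans (get0≤maxL α i) (n≤1+n _))) ⟩
      sumFrom 1 W (occ v i)                                      ∎

  occurrences-split : ∀ m v → m ≤ W → occurrences v ≡ occurrencesUpTo m v + occurrencesBeyond m v
  occurrences-split m v mW = trans
    (sumFrom-cong 1 ℓ (λ i _ _ → trans (cong (λ n → sumFrom 1 n (occ v i)) (sym (m+[n∸m]≡n mW))) (sumFrom-split 1 m (W ∸ m) (occ v i))))
    (sumFrom-+ 1 ℓ (λ i → sumFrom 1 m (occ v i)) (λ i → sumFrom (suc m) (W ∸ m) (occ v i)))

  occurrencesUpTo≤ : ∀ m v → 1 ≤ v → occurrencesUpTo m v ≤ m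
  occurrencesUpTo≤ m v lv = begin
    occurrencesUpTo m v                          ≡⟨ sumFrom-swap 1 ℓ 1 m (occ v) ⟩
    sumFrom 1 m (λ k → sumFrom 1 ℓ (λ i → occ v i k)) ≤⟨ sumFrom-mono-≤ 1 m (λ k lk _ → column-occurrences≤1 k v lv lk) ⟩
    sumFrom 1 m (λ _ → 1)                        ≡⟨ sumFrom-ones 1 m ⟩
    m                                            ∎
    where open ≤-Reasoning

  occurrencesBeyond-total : ∀ m → sumFrom 1 L (λ v → occurrencesBeyond m v) ≤ sumFrom 1 ℓ (λ i → a i ∸ m)
  occurrencesBeyond-total m = begin
    sumFrom 1 L (λ v → occurrencesBeyond m v)
      ≡⟨ sumFrom-swap 1 L 1 ℓ (λ v i → sumFrom (suc m) (W ∸ m) (occ v i)) ⟩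
    sumFrom 1 ℓ (λ i → sumFrom 1 L (λ v → sumFrom (suc m) (W ∸ m) (occ v i)))
      ≡⟨ sumFrom-cong 1 ℓ (λ i _ _ → sumFrom-swap 1 L (suc m) (W ∸ m) (λ v k → occ v i k)) ⟩
    sumFrom 1 ℓ (λ i → sumFrom (suc m) (W ∸ m) (λ k → sumFrom 1 L (λ v → occ v i k)))
      ≤⟨ sumFrom-mono-≤ 1 ℓ (λ i _ _ → sumFrom-mono-≤ (suc m) (W ∸ m) (λ k lk _ → cell-occurrences≤1 i k (≤-trans (s≤s z≤n) lk))) ⟩
    sumFrom 1 ℓ (λ i → sumFrom (suc m) (W ∸ m) (λ k → 𝟙 (k ≤ᵇ a i)))
      ≤⟨ sumFrom-mono-≤ 1 ℓ (λ i _ _ → sumFrom-𝟙-≤ᵇ (suc m) (W ∸ m) (a i)) ⟩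
    sumFrom 1 ℓ (λ i → a i ∸ m) ∎
    where
    open ≤-Reasoning
    sumFrom-𝟙-≤ᵇ : ∀ lo n x → sumFrom lo n (λ k → 𝟙 (k ≤ᵇ x)) ≤ suc x ∸ lo
    sumFrom-𝟙-≤ᵇ lo zero x = z≤n
    sumFrom-𝟙-≤ᵇ lo (suc n) x with lo ≤? x
    ... | yes q rewrite T⇒≡true (≤⇒≤ᵇ q) =
      subst (suc (sumFrom (suc lo) n (λ k → 𝟙 (k ≤ᵇ x))) ≤_) (sym (+-∸-assoc 1 q)) (s≤s (sumFrom-𝟙-≤ᵇ (suc lo) n x))
    ... | no q rewrite ¬T⇒≡false (λ t → q (≤ᵇ⇒≤ _ _ t)) =
      ≤-trans (sumFrom-𝟙-≤ᵇ (suc lo) n x) (∸-monoʳ-≤ (suc x) (n≤1+n lo))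

  weight≤W : ∀ v → 1 ≤ v → v ≤ L → b v ≤ W
  weight≤W v lv vL = subst (_≤ W) (occurrences≡weight v lv vL) (occurrencesUpTo≤ W v lv)

  weight∸≤occurrencesBeyond : ∀ m v → m ≤ W → 1 ≤ v → v ≤ L → b v ∸ m ≤ occurrencesBeyond m v
  weight∸≤occurrencesBeyond m v mW lv vL =
    subst (λ z → z ∸ m ≤ occurrencesBeyond m v) (trans (sym (occurrences-split m v mW)) (occurrences≡weight v lv vL))
      (≤-trans (∸-monoˡ-≤ m (+-monoˡ-≤ _ (occurrencesUpTo≤ m v lv))) (≤-reflexive (m+n∸m≡n m _)))

  weightExcess≤shapeExcess : ∀ m → sumFrom 1 L (λ v → b v ∸ m) ≤ sumFrom 1 ℓ (λ i → a i ∸ m)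
  weightExcess≤shapeExcess m with m ≤? W
  ... | yes mW = ≤-trans (sumFrom-mono-≤ 1 L (λ v lv v< → weight∸≤occurrencesBeyond m v mW lv (≤-pred v<))) (occurrencesBeyond-total m)
  ... | no mW = subst (_≤ _) (sym (sumFrom-zero 1 L (λ v → b v ∸ m)
                  (λ v lv v< → m≤n⇒m∸n≡0 (≤-trans (weight≤W v lv (≤-pred v<)) (<⇒≤ (≰⇒> mW)))))) z≤n

  occurrencesBeyond-step : ∀ m v → m < W →
    occurrencesBeyond m v ≡ sumFrom 1 ℓ (λ i → occ v i (suc m)) + occurrencesBeyond (suc m) v
  occurrencesBeyond-step m v m<W =
    trans (sumFrom-cong 1 ℓ (λ i _ _ → cong (λ n → sumFrom (suc m) n (occ v i)) (+-∸-assoc 1 m<W)))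
          (sumFrom-+ 1 ℓ (λ i → occ v i (suc m)) (λ i → sumFrom (suc (suc m)) (W ∸ suc m) (occ v i)))

  module ExcessEquality (excess≡ : ∀ m → sumFrom 1 L (λ v → b v ∸ m) ≡ sumFrom 1 ℓ (λ i → a i ∸ m)) where

    weight∸≡occurrencesBeyond : ∀ m v → m ≤ W → 1 ≤ v → v ≤ L → b v ∸ m ≡ occurrencesBeyond m v
    weight∸≡occurrencesBeyond m v mW lv vL =
      sumFrom-tight 1 L (λ v → b v ∸ m) (occurrencesBeyond m) (λ v lv v< → weight∸≤occurrencesBeyond m v mW lv (≤-pred v<))
        (≤-trans (occurrencesBeyond-total m) (≤-reflexive (sym (excess≡ m)))) v lv (s≤s vL)

    -- Equality forces each value v to occur exactly once in each of the columns 1, …, b v.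
    value-inColumn : ∀ m v → m < W → 1 ≤ v → v ≤ L → m < b v → ∃[ i ] (1 ≤ i × i ≤ ℓ × E i (suc m) ≡ v)
    value-inColumn m v m<W lv vL m<b with sumFrom-positive 1 ℓ (λ i → occ v i (suc m)) inColumn
      where
      column+rest : b v ∸ m ≡ sumFrom 1 ℓ (λ i → occ v i (suc m)) + (b v ∸ suc m)
      column+rest = trans (weight∸≡occurrencesBeyond m v (<⇒≤ m<W) lv vL)
        (trans (occurrencesBeyond-step m v m<W)
               (cong (sumFrom 1 ℓ (λ i → occ v i (suc m)) +_) (sym (weight∸≡occurrencesBeyond (suc m) v m<W lv vL))))
      inColumn : 1 ≤ sumFrom 1 ℓ (λ i → occ v i (suc m))
      inColumn with sumFrom 1 ℓ (λ i → occ v i (suc m)) in eq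
      ... | zero = ⊥-elim (1+n≢n (trans (sym (+-∸-assoc 1 m<b)) (trans column+rest (cong (_+ (b v ∸ suc m)) eq))))
      ... | suc _ = s≤s z≤n
    ... | i , li , ui , hit = i , li , ≤-pred ui , sym (≡ᵇ⇒≡ _ _ (1≤𝟙⇒T hit))

  module SameLength (L≡ℓ : L ≡ ℓ) (αpos : All (0 <_) α) where

    rowLength-positive : ∀ i → 1 ≤ i → i ≤ ℓ → 1 ≤ a i
    rowLength-positive = All-get0 α αpos

    entry≤ℓ : ∀ i k → 1 ≤ i → i ≤ ℓ → 1 ≤ k → k ≤ a i → E i k ≤ ℓ
    entry≤ℓ i k li iℓ lk ka = subst (E i k ≤_) L≡ℓ (≤ᵇ⇒≤ _ _ (all-get0 (rowOf t i) (all-concat⁻ t (HasWeight.bounded w) i) k lk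
      (subst (k ≤_) (sym (rowLength i li iℓ)) ka)))

    firstEntry≥row : ∀ i → 1 ≤ i → i ≤ ℓ → i ≤ E i 1
    firstEntry≥row (suc zero) _ iℓ = positive 1 1 ≤-refl iℓ ≤-refl (rowLength-positive 1 ≤-refl iℓ)
    firstEntry≥row (suc (suc i)) _ iℓ =
      ≤-trans (s≤s (firstEntry≥row (suc i) (s≤s z≤n) (<⇒≤ iℓ))) (firstColumn-< (suc i) (suc (suc i)) (s≤s z≤n) ≤-refl iℓ)

    firstEntry+rowsBelow≤ℓ : ∀ d i → i + d ≡ ℓ → 1 ≤ i → E i 1 + d ≤ ℓ
    firstEntry+rowsBelow≤ℓ zero i e li = subst (_≤ ℓ) (sym (+-identityʳ (E i 1)))
      (entry≤ℓ i 1 li iℓ ≤-refl (rowLength-positive i li iℓ))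
      where
      iℓ : i ≤ ℓ
      iℓ = ≤-reflexive (trans (sym (+-identityʳ i)) e)
    firstEntry+rowsBelow≤ℓ (suc d) i e li = begin
      E i 1 + suc d        ≡⟨ +-suc (E i 1) d ⟩
      suc (E i 1) + d      ≤⟨ +-monoˡ-≤ d (firstColumn-< i (suc i) li ≤-refl 1+i≤ℓ) ⟩
      E (suc i) 1 + d      ≤⟨ firstEntry+rowsBelow≤ℓ d (suc i) (trans (sym (+-suc i d)) e) (s≤s z≤n) ⟩
      ℓ                    ∎
      where
      open ≤-Reasoning
      1+i≤ℓ : suc i ≤ ℓ
      1+i≤ℓ = subst (suc i ≤_) e (subst (_≤ i + suc d) (+-comm i 1) (+-monoʳ-≤ i (s≤s z≤n)))

    firstEntry≡row : ∀ i → 1 ≤ i → i ≤ ℓ → E i 1 ≡ i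
    firstEntry≡row i li iℓ = ≤-antisym (+-cancelʳ-≤ (ℓ ∸ i) (E i 1) i
      (subst (E i 1 + (ℓ ∸ i) ≤_) (sym (m+[n∸m]≡n iℓ)) (firstEntry+rowsBelow≤ℓ (ℓ ∸ i) i (m+[n∸m]≡n iℓ) li)))
      (firstEntry≥row i li iℓ)

    ConstantRow : ℕ → Set
    ConstantRow s = ∀ k → 1 ≤ k → k ≤ a s → E s k ≡ s

    constantRow-occurrences : ∀ s → ConstantRow s → sumFrom 1 (a s) (occ s s) ≡ a s
    constantRow-occurrences s cs =
      trans (sumFrom-cong 1 (a s) (λ k lk k< → 𝟙-≡ᵇ-≡ (sym (cs k lk (≤-pred k<))))) (sumFrom-ones 1 (a s))

    module _ (p : ℕ) (p≤ℓ : p ≤ ℓ) (agree : ∀ v → 1 ≤ v → v < p → b v ≡ a v) where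

      -- An entry v < s + 1 in row s + 1 would be an extra copy of v beyond the a v copies filling row v.
      constantRow-step : ∀ s → (∀ s' → 1 ≤ s' → s' ≤ s → ConstantRow s') → suc s ≤ p → ConstantRow (suc s)
      constantRow-step s below s<p k lk ks = ≤-antisym entry≤ entry≥
        where
        sℓ : suc s ≤ ℓ
        sℓ = ≤-trans s<p p≤ℓ
        entry≤ : E (suc s) k ≤ suc s
        entry≤ = ≤-trans (entry≤firstEntry (suc s) k (s≤s z≤n) sℓ lk ks) (≤-reflexive (firstEntry≡row (suc s) (s≤s z≤n) sℓ))
        entry≥ : suc s ≤ E (suc s) k
        entry≥ with suc s ≤? E (suc s) k
        ... | yes q = q
        ... | no q = ⊥-elim (<-irrefl refl (≤-trans tooMany (≤-reflexive (trans (occurrencesInRows≡weight v lv vL) (agree v lv (≤-trans v<s s<p))))))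
          where
          v : ℕ
          v = E (suc s) k
          v<s : v < suc s
          v<s = ≰⇒> q
          lv : 1 ≤ v
          lv = positive (suc s) k (s≤s z≤n) sℓ lk ks
          vL : v ≤ L
          vL = subst (v ≤_) (sym L≡ℓ) (≤-trans (<⇒≤ v<s) sℓ)
          rowTotal : ℕ → ℕ
          rowTotal i = sumFrom 1 (a i) (occ v i)
          tooMany : suc (a v) ≤ sumFrom 1 ℓ rowTotal
          tooMany = begin
            suc (a v)                                      ≡⟨ +-comm 1 (a v) ⟩
            a v + 1                                        ≡⟨ cong₂ _+_ (constantRow-occurrences v (below v lv (≤-pred v<s))) (𝟙-≡ᵇ-≡ {v} refl) ⟨
            rowTotal v + occ v (suc s) k                   ≤⟨ +-monoʳ-≤ (rowTotal v) (term≤sumFrom 1 (a (suc s)) (occ v (suc s)) k lk (s≤s ks)) ⟩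
            rowTotal v + rowTotal (suc s)                  ≤⟨ twoTerms≤sumFrom 1 ℓ rowTotal v (suc s) (<⇒≢ v<s) lv (s≤s (≤-trans (<⇒≤ v<s) sℓ)) (s≤s z≤n) (s≤s sℓ) ⟩
            sumFrom 1 ℓ rowTotal                           ∎
            where open ≤-Reasoning

      rows-constant : ∀ s → s ≤ p → ∀ s' → 1 ≤ s' → s' ≤ s → ConstantRow s'
      rows-constant zero _ s' ls' s'≤ = ⊥-elim (<⇒≱ ls' s'≤)
      rows-constant (suc s) sp s' ls' s'≤ with s' ≟ suc s
      ... | yes refl = constantRow-step s (rows-constant s (<⇒≤ sp)) sp
      ... | no ne = rows-constant s (<⇒≤ sp) s' ls' (≤-pred (≤∧≢⇒< s'≤ ne))

    rows-constant-before : ∀ p → p ≤ ℓ → (∀ v → 1 ≤ v → v < p → b v ≡ a v) → ∀ s → 1 ≤ s → s ≤ p → ConstantRow s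
    rows-constant-before p p≤ℓ agree s ls s≤p = rows-constant p p≤ℓ agree p ≤-refl s ls s≤p

    -- The value p must occur in column a p + 1: not in row p (too short), not in
    -- an earlier (constant) row, and not in a later row by the triple condition.
    no-firstDifference : (∀ m → sumFrom 1 L (λ v → b v ∸ m) ≡ sumFrom 1 ℓ (λ i → a i ∸ m)) →
      ∀ p → 1 ≤ p → p ≤ ℓ → (∀ v → 1 ≤ v → v < p → b v ≡ a v) → ¬ (a p < b p)
    no-firstDifference excess≡ p lp p≤ℓ agree ap<bp
      with ExcessEquality.value-inColumn excess≡ (a p) p (s≤s (get0≤maxL α p)) lp (subst (p ≤_) (sym L≡ℓ) p≤ℓ) ap<bp
    ... | i , li , iℓ , E≡p with <-cmp i p
    ... | tri< i<p _ _ = earlierRow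
      where
      earlierRow : ⊥
      earlierRow with suc (a p) ≤? a i
      ... | yes q = <⇒≢ i<p (trans (sym (rows-constant-before p p≤ℓ agree i li (<⇒≤ i<p) (suc (a p)) (s≤s z≤n) q)) E≡p)
      ... | no q = <⇒≢ lp (sym (trans (sym E≡p) (entry-beyondRow i (suc (a p)) (≰⇒> q))))
    ... | tri≈ _ refl _ = <⇒≢ lp (sym (trans (sym E≡p) (entry-beyondRow p (suc (a p)) ≤-refl)))
    ... | tri> _ _ p<i = <-irrefl refl (subst (_< p) lastEntry≡p (subst (E p (a p) <_) E≡p laterRow))
      where
      lastEntry≡p : E p (a p) ≡ p
      lastEntry≡p = rows-constant-before p p≤ℓ agree p lp ≤-refl (a p) (rowLength-positive p lp p≤ℓ) ≤-refl
      laterRow : E p (suc (a p) ∸ 1) < E i (suc (a p))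
      laterRow = triple-anyColumn p i (suc (a p)) lp p<i iℓ (s≤s (rowLength-positive p lp p≤ℓ)) (λ z → <⇒≢ lp (sym (trans (sym E≡p) z)))
        (subst (_≤ E i (suc (a p))) (sym (entry-beyondRow p (suc (a p)) ≤-refl)) z≤n)

-- Triangularity

samePartition⇒sameExcess : ∀ α β → partitionOf β ≡ partitionOf α →
  ∀ m → sumFrom 1 (length β) (λ v → get0 β v ∸ m) ≡ sumFrom 1 (length α) (λ i → get0 α i ∸ m)
samePartition⇒sameExcess α β same m = begin
  sumFrom 1 (length β) (λ v → get0 β v ∸ m)   ≡⟨ excess-get0 m β ⟨
  excess m β                                 ≡⟨ excess-partitionOf m β ⟨
  excess m (partitionOf β)                   ≡⟨ cong (excess m) same ⟩
  excess m (partitionOf α)                   ≡⟨ excess-partitionOf m α ⟩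
  excess m α                                 ≡⟨ excess-get0 m α ⟩
  sumFrom 1 (length α) (λ i → get0 α i ∸ m)  ∎
  where open ≡-Reasoning

noComT-below : ∀ α β → All (0 <_) α → All (0 <_) β → β ▶ α → ¬ ComTsOfWeight α β
noComT-below α β αpos βpos β▶α (t , ok) = contradiction β▶α
  where
  c : IsComT α t
  c = isComT⇒IsComT α t (∧-fst {isComT α t} ok)
  open ComTCounting α β t c (weightOK⇒HasWeight β (concat t) (∧-snd {isComT α t} ok))
  contradiction : β ▶ α → ⊥
  contradiction (inj₁ λβ>λα) with >lex⇒excess< (partitionOf β) (partitionOf α) (partitionOf-decreasing β) (partitionOf-decreasing α) λβ>λα
  ... | m , α<β = <⇒≱ (subst₂ _<_ (trans (excess-partitionOf m α) (excess-get0 m α)) (trans (excess-partitionOf m β) (excess-get0 m β)) α<β)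
                      (weightExcess≤shapeExcess m)
  contradiction (inj₂ (same , β>α)) with >lex-firstDifference β α β>α
  ... | p , lp , p≤ℓ , agree , differ =
    SameLength.no-firstDifference sameLength αpos (samePartition⇒sameExcess α β same) p lp p≤ℓ agree differ
    where
    sameLength : length β ≡ length α
    sameLength = trans (sym (length-partitionOf β βpos)) (trans (cong length same) (length-partitionOf α αpos))

constantRows : ℕ → List ℕ → List (List ℕ)
constantRows j [] = []
constantRows j (x ∷ xs) = replicate x j ∷ constantRows (suc j) xs

length-constantRows : ∀ j xs → length (constantRows j xs) ≡ length xs
length-constantRows j [] = refl
length-constantRows j (x ∷ xs) = cong suc (length-constantRows (suc j) xs)

rowOf-constantRows : ∀ j xs p → rowOf (constantRows j xs) (suc p) ≡ replicate (get0 xs (suc p)) (j + p)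
rowOf-constantRows j [] p = refl
rowOf-constantRows j (x ∷ xs) zero = cong (replicate x) (sym (+-identityʳ j))
rowOf-constantRows j (x ∷ xs) (suc p) =
  trans (rowOf-constantRows (suc j) xs p) (cong (replicate (get0 xs (suc p))) (sym (+-suc j p)))

rowOf-constantRows₁ : ∀ xs i → 1 ≤ i → rowOf (constantRows 1 xs) i ≡ replicate (get0 xs i) i
rowOf-constantRows₁ xs (suc p) _ = rowOf-constantRows 1 xs p

constantRows-IsComT : ∀ α → All (0 <_) α → IsComT α (constantRows 1 α)
constantRows-IsComT α αpos = record
  { length≡ = length-constantRows 1 α
  ; rowLength = λ i li _ → trans (cong length (rowOf-constantRows₁ α i li)) (length-replicate (get0 α i))
  ; positive = λ i k li _ lk ka → subst (1 ≤_) (sym (entry≡row i k li lk ka)) li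
  ; rowDecreasing = rowDecreasing
  ; firstColumnIncreasing = firstColumnIncreasing
  ; triple = triple
  }
  where
  t : List (List ℕ)
  t = constantRows 1 α
  entry≡row : ∀ i k → 1 ≤ i → 1 ≤ k → k ≤ get0 α i → entry t i k ≡ i
  entry≡row i k li lk ka rewrite rowOf-constantRows₁ α i li = get0-replicate (get0 α i) i k lk ka
  rowDecreasing : ∀ i k → 1 ≤ i → i ≤ length α → 2 ≤ k → k ≤ get0 α i → entry t i k ≤ entry t i (k ∸ 1)
  rowDecreasing i (suc zero) _ _ (s≤s ()) _
  rowDecreasing i (suc (suc k)) li _ lk ka
    rewrite entry≡row i (suc (suc k)) li (s≤s z≤n) ka | entry≡row i (suc k) li (s≤s z≤n) (<⇒≤ ka) = ≤-refl
  1+i≤ℓ : ∀ i ℓ → 1 ≤ i → i ≤ ℓ ∸ 1 → suc i ≤ ℓ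
  1+i≤ℓ i (suc ℓ) _ h = s≤s h
  1+i≤ℓ i zero li h = ⊥-elim (<⇒≱ li h)
  firstColumnIncreasing : ∀ i → 1 ≤ i → i ≤ length α ∸ 1 → entry t i 1 < entry t (suc i) 1
  firstColumnIncreasing i li iℓ
    rewrite entry≡row i 1 li ≤-refl (All-get0 α αpos i li (≤-trans iℓ (m∸n≤m (length α) 1)))
          | entry≡row (suc i) 1 (s≤s z≤n) ≤-refl (All-get0 α αpos (suc i) (s≤s z≤n) (1+i≤ℓ i (length α) li iℓ)) = ≤-refl
  triple : ∀ i j k → 1 ≤ i → i ≤ length α → 1 ≤ j → j ≤ length α → 2 ≤ k → k ≤ maxL α → i < j →
      entry t j k ≢ 0 → entry t i k ≤ entry t j k → entry t i (k ∸ 1) < entry t j k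
  triple i j k li _ lj _ _ _ i<j nz _ rewrite rowOf-constantRows₁ α i li | rowOf-constantRows₁ α j lj
    with get0-replicate-0⊎ (get0 α j) j k
  ... | inj₁ z = ⊥-elim (nz z)
  ... | inj₂ e rewrite e with get0-replicate-0⊎ (get0 α i) i (k ∸ 1)
  ...   | inj₁ z rewrite z = ≤-trans (s≤s z≤n) i<j
  ...   | inj₂ e' rewrite e' = i<j

constantRows-HasWeight : ∀ α → HasWeight α (concat (constantRows 1 α))
constantRows-HasWeight α = record { bounded = bounded 1 α ≤-refl ; count = count }
  where
  bounded : ∀ j xs → j + length xs ≤ suc (length α) → T (all (λ x → x ≤ᵇ length α) (concat (constantRows j xs)))
  bounded j [] _ = tt
  bounded j (x ∷ xs) h = all-++⁺ (replicate x j) (concat (constantRows (suc j) xs))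
    (all-replicate x j (≤⇒≤ᵇ (≤-pred (≤-trans (m≤m+n (suc j) (length xs)) h′))))
    (bounded (suc j) xs h′)
    where
    h′ : suc j + length xs ≤ suc (length α)
    h′ = ≤-trans (≤-reflexive (sym (+-suc j (length xs)))) h
  count : ∀ v → 1 ≤ v → v ≤ length α → countOcc v (concat (constantRows 1 α)) ≡ get0 α v
  count v lv vℓ = begin
    countOcc v (concat (constantRows 1 α))
      ≡⟨ countOcc-concat v (constantRows 1 α) ⟩
    sumFrom 1 (length (constantRows 1 α)) (λ i → countOcc v (rowOf (constantRows 1 α) i))
      ≡⟨ cong (λ n → sumFrom 1 n (λ i → countOcc v (rowOf (constantRows 1 α) i))) (length-constantRows 1 α) ⟩
    sumFrom 1 (length α) (λ i → countOcc v (rowOf (constantRows 1 α) i))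
      ≡⟨ sumFrom-cong 1 (length α) (λ i li _ → trans (cong (countOcc v) (rowOf-constantRows₁ α i li)) (countOcc-replicate v (get0 α i) i)) ⟩
    sumFrom 1 (length α) (λ i → get0 α i * 𝟙 (v ≡ᵇ i))
      ≡⟨ sumFrom-delta 1 (length α) (get0 α) v lv (s≤s vℓ) ⟩
    get0 α v ∎
    where open ≡-Reasoning

constantRows-ComT : ∀ α → All (0 <_) α → ComTsOfWeight α α
constantRows-ComT α αpos = constantRows 1 α ,
  ∧-intro (IsComT⇒isComT α (constantRows 1 α) (constantRows-IsComT α αpos))
          (HasWeight⇒weightOK α (concat (constantRows 1 α)) (constantRows-HasWeight α))

comT-ofOwnWeight-unique : ∀ α (αpos : All (0 <_) α) (t : ComTsOfWeight α α) → t ≡ constantRows-ComT α αpos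
comT-ofOwnWeight-unique α αpos (t , ok) = Σ-T-≡ (rowOf-ext t (constantRows 1 α) (trans length≡ (sym (length-constantRows 1 α))) rows)
  where
  c : IsComT α t
  c = isComT⇒IsComT α t (∧-fst {isComT α t} ok)
  open IsComT c
  open ComTCounting α α t c (weightOK⇒HasWeight α (concat t) (∧-snd {isComT α t} ok))
  open SameLength refl αpos
  rows : ∀ s → 1 ≤ s → s ≤ length t → rowOf t s ≡ rowOf (constantRows 1 α) s
  rows s ls sl = trans
    (get0-ext (rowOf t s) (replicate (get0 α s) s) (trans (rowLength s ls sℓ) (sym (length-replicate (get0 α s))))
      (λ k lk kl → let ka = subst (k ≤_) (rowLength s ls sℓ) kl in
        trans (rows-constant-before (length α) ≤-refl (λ _ _ _ → refl) s ls sℓ k lk ka) (sym (get0-replicate (get0 α s) s k lk ka))))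
    (sym (rowOf-constantRows₁ α s ls))
    where
    sℓ : s ≤ length α
    sℓ = subst (s ≤_) length≡ sl

-- SSAFs

-- cellLess γ F i j i' j' unfolds to entryLessᵇ (val γ F i j) i j (val γ F i' j') i' j'.
entryLessᵇ : ℕ → ℕ → ℕ → ℕ → ℕ → ℕ → Bool
entryLessᵇ v i j v' i' j' = (v <ᵇ v') ∨ ((v ≡ᵇ v') ∧ ((i <ᵇ i') ∨ ((i ≡ᵇ i') ∧ (j' <ᵇ j))))

inversionTripleᵇ : ℕ → ℕ → ℕ → ℕ → ℕ → ℕ → ℕ → ℕ → ℕ → Bool
inversionTripleᵇ va ia ja vb ib jb vc ic jc =
    (entryLessᵇ va ia ja vc ic jc ∧ entryLessᵇ vc ic jc vb ib jb)
  ∨ ((entryLessᵇ vc ic jc vb ib jb ∧ entryLessᵇ vb ib jb va ia ja)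
  ∨ (entryLessᵇ vb ib jb va ia ja ∧ entryLessᵇ va ia ja vc ic jc))

EntryLess : ℕ → ℕ → ℕ → ℕ → ℕ → ℕ → Set
EntryLess v i j v' i' j' = v < v' ⊎ (v ≡ v' × (i < i' ⊎ (i ≡ i' × j' < j)))

InversionTriple : ℕ → ℕ → ℕ → ℕ → ℕ → ℕ → ℕ → ℕ → ℕ → Set
InversionTriple va ia ja vb ib jb vc ic jc =
    (EntryLess va ia ja vc ic jc × EntryLess vc ic jc vb ib jb)
  ⊎ ((EntryLess vc ic jc vb ib jb × EntryLess vb ib jb va ia ja)
  ⊎ (EntryLess vb ib jb va ia ja × EntryLess va ia ja vc ic jc))

entryLessᵇ⇒EntryLess : ∀ v i j v' i' j' → T (entryLessᵇ v i j v' i' j') → EntryLess v i j v' i' j'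
entryLessᵇ⇒EntryLess v i j v' i' j' h with ∨-elim {v <ᵇ v'} h
... | inj₁ x = inj₁ (<ᵇ⇒< _ _ x)
... | inj₂ y with ∨-elim {i <ᵇ i'} (∧-snd {v ≡ᵇ v'} y)
...   | inj₁ z = inj₂ (≡ᵇ⇒≡ _ _ (∧-fst {v ≡ᵇ v'} y) , inj₁ (<ᵇ⇒< _ _ z))
...   | inj₂ z = inj₂ (≡ᵇ⇒≡ _ _ (∧-fst {v ≡ᵇ v'} y) , inj₂ (≡ᵇ⇒≡ _ _ (∧-fst {i ≡ᵇ i'} z) , <ᵇ⇒< _ _ (∧-snd {i ≡ᵇ i'} z)))

EntryLess⇒entryLessᵇ : ∀ v i j v' i' j' → EntryLess v i j v' i' j' → T (entryLessᵇ v i j v' i' j')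
EntryLess⇒entryLessᵇ v i j v' i' j' (inj₁ x) = ∨-inl (<⇒<ᵇ x)
EntryLess⇒entryLessᵇ v i j v' i' j' (inj₂ (e , inj₁ z)) = ∨-inr {v <ᵇ v'} (∧-intro (≡⇒≡ᵇ _ _ e) (∨-inl (<⇒<ᵇ z)))
EntryLess⇒entryLessᵇ v i j v' i' j' (inj₂ (e , inj₂ (e' , z))) =
  ∨-inr {v <ᵇ v'} (∧-intro (≡⇒≡ᵇ _ _ e) (∨-inr {i <ᵇ i'} (∧-intro (≡⇒≡ᵇ _ _ e') (<⇒<ᵇ z))))

inversionTripleᵇ⇒InversionTriple : ∀ va ia ja vb ib jb vc ic jc →
  T (inversionTripleᵇ va ia ja vb ib jb vc ic jc) → InversionTriple va ia ja vb ib jb vc ic jc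
inversionTripleᵇ⇒InversionTriple va ia ja vb ib jb vc ic jc h
  with ∨-elim {entryLessᵇ va ia ja vc ic jc ∧ entryLessᵇ vc ic jc vb ib jb} h
... | inj₁ x = inj₁ (entryLessᵇ⇒EntryLess _ _ _ _ _ _ (∧-fst {entryLessᵇ va ia ja vc ic jc} x) , entryLessᵇ⇒EntryLess _ _ _ _ _ _ (∧-snd {entryLessᵇ va ia ja vc ic jc} x))
... | inj₂ y with ∨-elim {entryLessᵇ vc ic jc vb ib jb ∧ entryLessᵇ vb ib jb va ia ja} y
...   | inj₁ x = inj₂ (inj₁ (entryLessᵇ⇒EntryLess _ _ _ _ _ _ (∧-fst {entryLessᵇ vc ic jc vb ib jb} x) , entryLessᵇ⇒EntryLess _ _ _ _ _ _ (∧-snd {entryLessᵇ vc ic jc vb ib jb} x)))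
...   | inj₂ x = inj₂ (inj₂ (entryLessᵇ⇒EntryLess _ _ _ _ _ _ (∧-fst {entryLessᵇ vb ib jb va ia ja} x) , entryLessᵇ⇒EntryLess _ _ _ _ _ _ (∧-snd {entryLessᵇ vb ib jb va ia ja} x)))

InversionTriple⇒inversionTripleᵇ : ∀ va ia ja vb ib jb vc ic jc →
  InversionTriple va ia ja vb ib jb vc ic jc → T (inversionTripleᵇ va ia ja vb ib jb vc ic jc)
InversionTriple⇒inversionTripleᵇ va ia ja vb ib jb vc ic jc (inj₁ (x , y)) =
  ∨-inl (∧-intro (EntryLess⇒entryLessᵇ _ _ _ _ _ _ x) (EntryLess⇒entryLessᵇ _ _ _ _ _ _ y))
InversionTriple⇒inversionTripleᵇ va ia ja vb ib jb vc ic jc (inj₂ (inj₁ (x , y))) =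
  ∨-inr {entryLessᵇ va ia ja vc ic jc ∧ entryLessᵇ vc ic jc vb ib jb}
    (∨-inl (∧-intro (EntryLess⇒entryLessᵇ _ _ _ _ _ _ x) (EntryLess⇒entryLessᵇ _ _ _ _ _ _ y)))
InversionTriple⇒inversionTripleᵇ va ia ja vb ib jb vc ic jc (inj₂ (inj₂ (x , y))) =
  ∨-inr {entryLessᵇ va ia ja vc ic jc ∧ entryLessᵇ vc ic jc vb ib jb}
    (∨-inr {entryLessᵇ vc ic jc vb ib jb ∧ entryLessᵇ vb ib jb va ia ja}
      (∧-intro (EntryLess⇒entryLessᵇ _ _ _ _ _ _ x) (EntryLess⇒entryLessᵇ _ _ _ _ _ _ y)))

EntryLess-earlierRow⇒≤ : ∀ {v i j v' i' j'} → i < i' → EntryLess v i j v' i' j' → v ≤ v'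
EntryLess-earlierRow⇒≤ _ (inj₁ x) = <⇒≤ x
EntryLess-earlierRow⇒≤ _ (inj₂ (e , _)) = ≤-reflexive e

EntryLess-laterRow⇒< : ∀ {v i j v' i' j'} → i' < i → EntryLess v i j v' i' j' → v < v'
EntryLess-laterRow⇒< _ (inj₁ x) = x
EntryLess-laterRow⇒< i'<i (inj₂ (e , inj₁ z)) = ⊥-elim (<-asym i'<i z)
EntryLess-laterRow⇒< i'<i (inj₂ (e , inj₂ (refl , z))) = ⊥-elim (<-irrefl refl i'<i)

≤⇒EntryLess-sameRow : ∀ {v i j v' j'} → j' < j → v ≤ v' → EntryLess v i j v' i j'
≤⇒EntryLess-sameRow j'<j le with m≤n⇒m<n∨m≡n le
... | inj₁ x = inj₁ x
... | inj₂ e = inj₂ (e , inj₂ (refl , j'<j))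

augmented : ℕ → List ℕ → ℕ → ℕ
augmented i r k = if k ≡ᵇ 0 then i else get0 r k

module RowPair (i j : ℕ) (i<j : i < j) (r r' : List ℕ)
  (decreasingA : ∀ k → 1 ≤ k → k ≤ length r → augmented i r k ≤ augmented i r (k ∸ 1))
  (decreasingB : ∀ k → 1 ≤ k → k ≤ length r' → augmented j r' k ≤ augmented j r' (k ∸ 1))
  (positiveA : ∀ k → 1 ≤ k → k ≤ length r → 1 ≤ augmented i r k)
  (positiveB : ∀ k → 1 ≤ k → k ≤ length r' → 1 ≤ augmented j r' k)
  (firstA : 1 ≤ length r → augmented i r 1 ≡ i)
  (firstB : 1 ≤ length r' → augmented j r' 1 ≡ j)
  where

  private
    A B : ℕ → ℕ
    A = augmented i r
    B = augmented j r'
    la lb : ℕ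
    la = length r
    lb = length r'

  SameColumnDistinct DiagonalDistinct TypeATriples TypeBTriples ComTTriples : Set
  SameColumnDistinct = ∀ k → k ≤ la → k ≤ lb → A k ≢ B k
  DiagonalDistinct = ∀ k → 1 ≤ k → k ≤ lb → k ∸ 1 ≤ la → B k ≢ A (k ∸ 1)
  TypeATriples = lb ≤ la → ∀ k → 1 ≤ k → k ≤ lb → T (inversionTripleᵇ (A k) i k (B k) j k (A (k ∸ 1)) i (k ∸ 1))
  TypeBTriples = la < lb → ∀ k → k ≤ la → T (inversionTripleᵇ (A k) i k (B k) j k (B (suc k)) j (suc k))
  ComTTriples = ∀ k → 2 ≤ k → B k ≢ 0 → A k ≤ B k → A (k ∸ 1) < B k

  private
    A-beyond : ∀ k → la < k → A k ≡ 0
    A-beyond (suc k) l = get0-outOfRange r (suc k) l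
    B-beyond : ∀ k → lb < k → B k ≡ 0
    B-beyond (suc k) l = get0-outOfRange r' (suc k) l

    A-inRow : ∀ k → A k ≢ 0 → k ≤ la
    A-inRow k nz with k ≤? la
    ... | yes q = q
    ... | no q = ⊥-elim (nz (A-beyond k (≰⇒> q)))
    B-inRow : ∀ k → B k ≢ 0 → k ≤ lb
    B-inRow k nz with k ≤? lb
    ... | yes q = q
    ... | no q = ⊥-elim (nz (B-beyond k (≰⇒> q)))

    positive⇒≢0 : ∀ {x} → 1 ≤ x → x ≢ 0
    positive⇒≢0 l e = <⇒≢ l (sym e)

    k∸1<k : ∀ k → 1 ≤ k → k ∸ 1 < k
    k∸1<k (suc k) _ = ≤-refl

  module FromSSAF (sameColumn : SameColumnDistinct) (diagonal : DiagonalDistinct)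
                  (typeA : TypeATriples) (typeB : TypeBTriples) where

    -- Type B triples keep a longer lower row entrywise at least the upper row.
    longerLowerRow-notBelow : la < lb → ∀ k → k ≤ la → B k < A k → ⊥
    longerLowerRow-notBelow la<lb zero _ lt = <-asym i<j lt
    longerLowerRow-notBelow la<lb (suc k) kla lt
      with inversionTripleᵇ⇒InversionTriple (A k) i k (B k) j k (B (suc k)) j (suc k) (typeB la<lb k (<⇒≤ kla))
    ... | inj₁ (ac , _) = <⇒≱ (<-≤-trans lt (decreasingA (suc k) (s≤s z≤n) kla)) (EntryLess-earlierRow⇒≤ i<j ac)
    ... | inj₂ (inj₁ (_ , ba)) = longerLowerRow-notBelow la<lb k (<⇒≤ kla) (EntryLess-laterRow⇒< i<j ba)
    ... | inj₂ (inj₂ (ba , _)) = longerLowerRow-notBelow la<lb k (<⇒≤ kla) (EntryLess-laterRow⇒< i<j ba)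

    comTTriples : ComTTriples
    comTTriples (suc zero) (s≤s ()) _ _
    comTTriples (suc (suc k)) _ nz le with lb ≤? la
    ... | yes lb≤la
      with inversionTripleᵇ⇒InversionTriple (A (suc (suc k))) i (suc (suc k)) (B (suc (suc k))) j (suc (suc k)) (A (suc k)) i (suc k)
             (typeA lb≤la (suc (suc k)) (s≤s z≤n) (B-inRow (suc (suc k)) nz))
    ...   | inj₁ (_ , cb) = ≤∧≢⇒< (EntryLess-earlierRow⇒≤ i<j cb) (λ e → diagonal (suc (suc k)) (s≤s z≤n) kb
                              (≤-trans (n≤1+n _) (≤-trans kb lb≤la)) (sym e))
      where
      kb : suc (suc k) ≤ lb
      kb = B-inRow (suc (suc k)) nz
    ...   | inj₂ (inj₁ (_ , ba)) = ⊥-elim (<⇒≱ (EntryLess-laterRow⇒< i<j ba) le)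
    ...   | inj₂ (inj₂ (ba , _)) = ⊥-elim (<⇒≱ (EntryLess-laterRow⇒< i<j ba) le)
    comTTriples (suc (suc k)) _ nz le | no lb≰la with suc (suc k) ≤? suc la
    ... | yes kla
      with inversionTripleᵇ⇒InversionTriple (A (suc k)) i (suc k) (B (suc k)) j (suc k) (B (suc (suc k))) j (suc (suc k))
             (typeB (≰⇒> lb≰la) (suc k) (≤-pred kla))
    ...   | inj₁ (ac , _) = ≤∧≢⇒< (EntryLess-earlierRow⇒≤ i<j ac) (λ e → diagonal (suc (suc k)) (s≤s z≤n) (B-inRow (suc (suc k)) nz) (≤-pred kla) (sym e))
    ...   | inj₂ (inj₁ (_ , ba)) = ⊥-elim (longerLowerRow-notBelow (≰⇒> lb≰la) (suc k) (≤-pred kla) (EntryLess-laterRow⇒< i<j ba))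
    ...   | inj₂ (inj₂ (ba , _)) = ⊥-elim (longerLowerRow-notBelow (≰⇒> lb≰la) (suc k) (≤-pred kla) (EntryLess-laterRow⇒< i<j ba))
    comTTriples (suc (suc k)) _ nz le | no lb≰la | no kla rewrite A-beyond (suc k) (≤-pred (≰⇒> kla)) = n≢0⇒n>0 nz

  module FromComT (comT : ComTTriples) where

    sameColumnDistinct : SameColumnDistinct
    sameColumnDistinct zero _ _ e = <⇒≢ i<j e
    sameColumnDistinct (suc zero) k≤la k≤lb e = <⇒≢ i<j (trans (sym (firstA k≤la)) (trans e (firstB k≤lb)))
    sameColumnDistinct (suc (suc k)) k≤la k≤lb e = <-irrefl refl (<-≤-trans
      (comT (suc (suc k)) (s≤s (s≤s z≤n)) (positive⇒≢0 (positiveB _ (s≤s z≤n) k≤lb)) (≤-reflexive e))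
      (subst (_≤ A (suc k)) e (decreasingA (suc (suc k)) (s≤s z≤n) k≤la)))

    diagonalDistinct : DiagonalDistinct
    diagonalDistinct (suc zero) _ k≤lb _ e = <⇒≢ i<j (sym (trans (sym (firstB k≤lb)) e))
    diagonalDistinct (suc (suc k)) _ k≤lb _ e with A (suc (suc k)) ≤? B (suc (suc k))
    ... | yes le = <⇒≢ (comT (suc (suc k)) (s≤s (s≤s z≤n)) (positive⇒≢0 (positiveB _ (s≤s z≤n) k≤lb)) le) (sym e)
    ... | no gt = <⇒≱ (≰⇒> gt) (subst (A (suc (suc k)) ≤_) (sym e)
            (decreasingA (suc (suc k)) (s≤s z≤n) (A-inRow (suc (suc k)) (λ z → gt (subst (_≤ B (suc (suc k))) (sym z) z≤n)))))

    typeATriples : TypeATriples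
    typeATriples lb≤la k lk k≤lb with <-cmp (A k) (B k)
    ... | tri< x _ _ = InversionTriple⇒inversionTripleᵇ (A k) i k (B k) j k (A (k ∸ 1)) i (k ∸ 1)
          (inj₁ (≤⇒EntryLess-sameRow (k∸1<k k lk) (decreasingA k lk (≤-trans k≤lb lb≤la)) , inj₁ (leftOfA<B k lk k≤lb x)))
      where
      leftOfA<B : ∀ k → 1 ≤ k → k ≤ lb → A k < B k → A (k ∸ 1) < B k
      leftOfA<B (suc zero) _ k≤lb _ = subst (i <_) (sym (firstB k≤lb)) i<j
      leftOfA<B (suc (suc k)) _ k≤lb x = comT (suc (suc k)) (s≤s (s≤s z≤n)) (positive⇒≢0 (positiveB _ (s≤s z≤n) k≤lb)) (<⇒≤ x)
    ... | tri≈ _ e _ = ⊥-elim (sameColumnDistinct k (≤-trans k≤lb lb≤la) k≤lb e)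
    ... | tri> _ _ x = InversionTriple⇒inversionTripleᵇ (A k) i k (B k) j k (A (k ∸ 1)) i (k ∸ 1)
          (inj₂ (inj₂ (inj₁ x , ≤⇒EntryLess-sameRow (k∸1<k k lk) (decreasingA k lk (≤-trans k≤lb lb≤la)))))

    -- Once B m < A (m − 1), the triple condition keeps B below A up to the end
    -- of the shorter row A, where A is 0.
    lowerRow-cannotDrop : ∀ d m → m + d ≡ suc la → 2 ≤ m → B m < A (m ∸ 1) → la < lb → ⊥
    lowerRow-cannotDrop d (suc zero) _ (s≤s ()) _ _
    lowerRow-cannotDrop d (suc (suc m)) e _ lt la<lb = go d e
      where
      m≤lb : suc (suc m) ≤ lb
      m≤lb = ≤-trans (subst (suc (suc m) ≤_) e (m≤m+n (suc (suc m)) d)) la<lb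
      B<A : B (suc (suc m)) < A (suc (suc m))
      B<A with A (suc (suc m)) ≤? B (suc (suc m))
      ... | yes le = ⊥-elim (<-asym lt (comT (suc (suc m)) (s≤s (s≤s z≤n)) (positive⇒≢0 (positiveB _ (s≤s z≤n) m≤lb)) le))
      ... | no gt = ≰⇒> gt
      go : ∀ d → suc (suc m) + d ≡ suc la → ⊥
      go zero e' = ⊥-elim (n≮0 (subst (B (suc (suc m)) <_) (A-beyond (suc (suc m)) (≤-reflexive (sym (trans (sym (+-identityʳ _)) e')))) B<A))
      go (suc d') e' = lowerRow-cannotDrop d' (suc (suc (suc m))) (trans (sym (+-suc (suc (suc m)) d')) e') (s≤s (s≤s z≤n))
          (≤-<-trans (decreasingB (suc (suc (suc m))) (s≤s z≤n) m+3≤lb) B<A) la<lb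
        where
        m+3≤lb : suc (suc (suc m)) ≤ lb
        m+3≤lb = ≤-trans (subst (suc (suc (suc m)) ≤_) (sym (+-suc (suc (suc m)) d')) (s≤s (m≤m+n _ d'))) (≤-trans (≤-reflexive e') la<lb)

    typeBTriples : TypeBTriples
    typeBTriples la<lb k k≤la with <-cmp (A k) (B (suc k))
    ... | tri< x _ _ = InversionTriple⇒inversionTripleᵇ (A k) i k (B k) j k (B (suc k)) j (suc k)
          (inj₁ (inj₁ x , ≤⇒EntryLess-sameRow ≤-refl (decreasingB (suc k) (s≤s z≤n) (≤-<-trans k≤la la<lb))))
    ... | tri≈ _ e _ = ⊥-elim (diagonalDistinct (suc k) (s≤s z≤n) (≤-<-trans k≤la la<lb) k≤la (sym e))
    ... | tri> _ _ y with <-cmp (A k) (B k)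
    ...   | tri> _ _ z = InversionTriple⇒inversionTripleᵇ (A k) i k (B k) j k (B (suc k)) j (suc k)
            (inj₂ (inj₁ (≤⇒EntryLess-sameRow ≤-refl (decreasingB (suc k) (s≤s z≤n) (≤-<-trans k≤la la<lb)) , inj₁ z)))
    ...   | tri≈ _ e _ = ⊥-elim (sameColumnDistinct k k≤la (<⇒≤ (≤-<-trans k≤la la<lb)) e)
    ...   | tri< z _ _ = ⊥-elim (drop k k≤la y)
      where
      drop : ∀ k → k ≤ la → B (suc k) < A k → ⊥
      drop zero _ y' = <-asym i<j (subst (_< i) (firstB (≤-trans (s≤s z≤n) la<lb)) y')
      drop (suc k) k≤la y' = lowerRow-cannotDrop (la ∸ suc k) (suc (suc k)) (cong suc (m+[n∸m]≡n k≤la)) (s≤s (s≤s z≤n)) y' la<lb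

shapeOK⇒≡map-length : ∀ γ F → T (shapeOK γ F) → γ ≡ map length F
shapeOK⇒≡map-length γ F h = get0-ext γ (map length F) (trans (sym length-F) (sym (length-map length F)))
  (λ k lk kl → trans (sym (≡ᵇ⇒≡ _ _ (∧-fst {length (rowOf F k) ≡ᵇ get0 γ k} (allIn-elim (∧-snd {length F ≡ᵇ length γ} h) k lk kl))))
                     (sym (get0-map-length F k)))
  where
  length-F : length F ≡ length γ
  length-F = ≡ᵇ⇒≡ _ _ (∧-fst {length F ≡ᵇ length γ} h)

module _ (F : List (List ℕ)) where

  private
    γ : List ℕ
    γ = map length F
    n : ℕ
    n = length γ
    len : ℕ → ℕ
    len = get0 γ
    V : ℕ → ℕ → ℕ
    V = val γ F

  record IsSSAF : Set where
    field
      positive : ∀ i → 1 ≤ i → i ≤ n → ∀ k → 1 ≤ k → k ≤ length (rowOf F i) → 1 ≤ get0 (rowOf F i) k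
      rowDecreasing : ∀ i → 1 ≤ i → i ≤ n → ∀ k → 1 ≤ k → k ≤ len i → V i k ≤ V i (k ∸ 1)
      sameColumnDistinct : ∀ i i' → 1 ≤ i → i ≤ n → 1 ≤ i' → i' ≤ n → i < i' →
        ∀ j → j ≤ len i → j ≤ len i' → V i j ≢ V i' j
      diagonalDistinct : ∀ i i' → 1 ≤ i → i ≤ n → 1 ≤ i' → i' ≤ n → i' < i →
        ∀ j → 1 ≤ j → j ≤ len i → j ∸ 1 ≤ len i' → V i j ≢ V i' (j ∸ 1)
      typeA : ∀ i j → 1 ≤ i → i ≤ n → 1 ≤ j → j ≤ n → i < j → len j ≤ len i →
        ∀ k → 1 ≤ k → k ≤ len j → T (invTriple γ F i k j k i (k ∸ 1))
      typeB : ∀ i j → 1 ≤ i → i ≤ n → 1 ≤ j → j ≤ n → i < j → len i < len j →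
        ∀ k → k ≤ len i → T (invTriple γ F i k j k j (suc k))

  private
    shape decreasing attacking typesA typesB : Bool
    shape = shapeOK γ F
    decreasing = rowsDecreasing γ F
    attacking = nonAttacking γ F
    typesA = typeAOK γ F
    typesB = typeBOK γ F
    attackP : ℕ → ℕ → ℕ → Bool
    attackP i i' j = (((i <ᵇ i') ∧ isCell γ F i' j) ⇒ᵇ not (V i j ≡ᵇ V i' j))
      ∧ (((i' <ᵇ i) ∧ (1 ≤ᵇ j) ∧ isCell γ F i' (j ∸ 1)) ⇒ᵇ not (V i j ≡ᵇ V i' (j ∸ 1)))
    typeBP : ℕ → ℕ → ℕ → Bool
    typeBP i j k = ((i <ᵇ j) ∧ (len i <ᵇ len j)) ⇒ᵇ invTriple γ F i k j k j (suc k)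

    isCell-intro : ∀ i j → 1 ≤ i → i ≤ n → j ≤ len i → T (isCell γ F i j)
    isCell-intro i j li iN jL = ∧-intro (≤⇒≤ᵇ li) (∧-intro (≤⇒≤ᵇ iN) (≤⇒≤ᵇ jL))

    isCell⇒inRow : ∀ i j → T (isCell γ F i j) → j ≤ len i
    isCell⇒inRow i j h = ≤ᵇ⇒≤ _ _ (∧-snd {i ≤ᵇ n} (∧-snd {1 ≤ᵇ i} h))

  isSSAF⇒IsSSAF : T (isSSAF γ F) → IsSSAF
  isSSAF⇒IsSSAF h = record
    { positive = λ i li iN k lk kl → ≤ᵇ⇒≤ _ _ (all-get0 (rowOf F i)
        (∧-snd {length (rowOf F i) ≡ᵇ len i} (allIn-elim (∧-snd {length F ≡ᵇ n} hShape) i li iN)) k lk kl)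
    ; rowDecreasing = λ i li iN k lk kL → ≤ᵇ⇒≤ _ _ (allIn-elim (allIn-elim hDecreasing i li iN) k lk kL)
    ; sameColumnDistinct = λ i i' li iN li' i'N lt j jL jL' → T-not-≡ᵇ⇒≢ (⇒ᵇ-elim
        (∧-fst {((i <ᵇ i') ∧ isCell γ F i' j) ⇒ᵇ not (V i j ≡ᵇ V i' j)} (attack i i' li iN li' i'N j jL))
        (∧-intro (<⇒<ᵇ lt) (isCell-intro i' j li' i'N jL')))
    ; diagonalDistinct = λ i i' li iN li' i'N lt j lj jL jL' → T-not-≡ᵇ⇒≢ (⇒ᵇ-elim
        (∧-snd {((i <ᵇ i') ∧ isCell γ F i' j) ⇒ᵇ not (V i j ≡ᵇ V i' j)} (attack i i' li iN li' i'N j jL))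
        (∧-intro (<⇒<ᵇ lt) (∧-intro (≤⇒≤ᵇ lj) (isCell-intro i' (j ∸ 1) li' i'N jL'))))
    ; typeA = λ i j li iN lj jN lt le k lk kL →
        ⇒ᵇ-elim (allIn-elim (allIn-elim (allIn-elim hTypeA i li iN) j lj jN) k lk kL) (∧-intro (<⇒<ᵇ lt) (≤⇒≤ᵇ le))
    ; typeB = λ i j li iN lj jN lt le k kL →
        ⇒ᵇ-elim (allIn-elim {0} {len i} {typeBP i j} (allIn-elim (allIn-elim hTypeB i li iN) j lj jN) k z≤n kL)
          (∧-intro (<⇒<ᵇ lt) (<⇒<ᵇ le))
    }
    where
    hShape : T shape
    hShape = ∧-fst {shape} h
    hDecreasing : T decreasing
    hDecreasing = ∧-fst {decreasing} (∧-snd {shape} h)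
    hAttacking : T attacking
    hAttacking = ∧-fst {attacking} (∧-snd {decreasing} (∧-snd {shape} h))
    hTypeA : T typesA
    hTypeA = ∧-fst {typesA} (∧-snd {attacking} (∧-snd {decreasing} (∧-snd {shape} h)))
    hTypeB : T typesB
    hTypeB = ∧-snd {typesA} (∧-snd {attacking} (∧-snd {decreasing} (∧-snd {shape} h)))
    attack : ∀ i i' → 1 ≤ i → i ≤ n → 1 ≤ i' → i' ≤ n → ∀ j → j ≤ len i → T (attackP i i' j)
    attack i i' li iN li' i'N j jL = allIn-elim {0} {len i} {attackP i i'} (allIn-elim (allIn-elim hAttacking i li iN) i' li' i'N) j z≤n jL

  IsSSAF⇒isSSAF : IsSSAF → T (isSSAF γ F)
  IsSSAF⇒isSSAF s = ∧-intro hShape (∧-intro hDecreasing (∧-intro hAttacking (∧-intro hTypeA hTypeB)))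
    where
    open IsSSAF s
    hShape : T shape
    hShape = ∧-intro (≡⇒≡ᵇ _ _ (sym (length-map length F))) (allIn-intro (λ i li iN →
      ∧-intro (≡⇒≡ᵇ _ _ (sym (get0-map-length F i))) (get0-all (rowOf F i) (λ k lk kl → ≤⇒≤ᵇ (positive i li iN k lk kl)))))
    hDecreasing : T decreasing
    hDecreasing = allIn-intro (λ i li iN → allIn-intro (λ k lk kL → ≤⇒≤ᵇ (rowDecreasing i li iN k lk kL)))
    hAttacking : T attacking
    hAttacking = allIn-intro (λ i li iN → allIn-intro (λ i' li' i'N → allIn-intro {0} {len i} {attackP i i'} (λ j _ jL →
      ∧-intro (⇒ᵇ-intro (λ c → ≢⇒T-not-≡ᵇ (sameColumnDistinct i i' li iN li' i'N (<ᵇ⇒< _ _ (∧-fst {i <ᵇ i'} c)) j jL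
                 (isCell⇒inRow i' j (∧-snd {i <ᵇ i'} c)))))
              (⇒ᵇ-intro (λ c → ≢⇒T-not-≡ᵇ (diagonalDistinct i i' li iN li' i'N (<ᵇ⇒< _ _ (∧-fst {i' <ᵇ i} c)) j
                 (≤ᵇ⇒≤ _ _ (∧-fst {1 ≤ᵇ j} (∧-snd {i' <ᵇ i} c))) jL
                 (isCell⇒inRow i' (j ∸ 1) (∧-snd {1 ≤ᵇ j} (∧-snd {i' <ᵇ i} c)))))))))
    hTypeA : T typesA
    hTypeA = allIn-intro (λ i li iN → allIn-intro (λ j lj jN → allIn-intro (λ k lk kL → ⇒ᵇ-intro (λ c →
      typeA i j li iN lj jN (<ᵇ⇒< _ _ (∧-fst {i <ᵇ j} c)) (≤ᵇ⇒≤ _ _ (∧-snd {i <ᵇ j} c)) k lk kL))))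
    hTypeB : T typesB
    hTypeB = allIn-intro (λ i li iN → allIn-intro (λ j lj jN → allIn-intro {0} {len i} {typeBP i j} (λ k _ kL → ⇒ᵇ-intro (λ c →
      typeB i j li iN lj jN (<ᵇ⇒< _ _ (∧-fst {i <ᵇ j} c)) (<ᵇ⇒< _ _ (∧-snd {i <ᵇ j} c)) k kL))))

-- Deleting and reinserting empty rows

firstEntry : List ℕ → ℕ
firstEntry r = get0 r 1

NonEmpty : List ℕ → Set
NonEmpty r = 1 ≤ length r

dropEmpty : List (List ℕ) → List (List ℕ)
dropEmpty [] = []
dropEmpty ([] ∷ F) = dropEmpty F
dropEmpty ((x ∷ r) ∷ F) = (x ∷ r) ∷ dropEmpty F

withEmptyRows : ℕ → List (List ℕ) → List (List ℕ)
withEmptyRows n F = replicate n [] ++ F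

-- Rows are moved to the positions given by their first entries; c is the
-- position of the previous row.
placeRows : ℕ → List (List ℕ) → List (List ℕ)
placeRows c [] = []
placeRows c (r ∷ t) = withEmptyRows (firstEntry r ∸ suc c) (r ∷ placeRows (firstEntry r) t)

dropEmpty-withEmptyRows : ∀ n F → dropEmpty (withEmptyRows n F) ≡ dropEmpty F
dropEmpty-withEmptyRows zero F = refl
dropEmpty-withEmptyRows (suc n) F = dropEmpty-withEmptyRows n F

dropEmpty-placeRows : ∀ c t → All NonEmpty t → dropEmpty (placeRows c t) ≡ t
dropEmpty-placeRows c [] _ = refl
dropEmpty-placeRows c ((x ∷ r) ∷ t) (_ ∷ h) =
  trans (dropEmpty-withEmptyRows (x ∸ suc c) ((x ∷ r) ∷ placeRows x t)) (cong ((x ∷ r) ∷_) (dropEmpty-placeRows x t h))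

concat-dropEmpty : ∀ F → concat (dropEmpty F) ≡ concat F
concat-dropEmpty [] = refl
concat-dropEmpty ([] ∷ F) = concat-dropEmpty F
concat-dropEmpty ((x ∷ r) ∷ F) = cong ((x ∷ r) ++_) (concat-dropEmpty F)

concat-placeRows : ∀ c t → concat (placeRows c t) ≡ concat t
concat-placeRows c [] = refl
concat-placeRows c (r ∷ t) = trans (concat-withEmptyRows (firstEntry r ∸ suc c)) (cong (r ++_) (concat-placeRows (firstEntry r) t))
  where
  concat-withEmptyRows : ∀ n → concat (withEmptyRows n (r ∷ placeRows (firstEntry r) t)) ≡ concat (r ∷ placeRows (firstEntry r) t)
  concat-withEmptyRows zero = refl
  concat-withEmptyRows (suc n) = concat-withEmptyRows n

delZeros-map-length : ∀ F → delZeros (map length F) ≡ map length (dropEmpty F)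
delZeros-map-length [] = refl
delZeros-map-length ([] ∷ F) = delZeros-map-length F
delZeros-map-length ((x ∷ r) ∷ F) = cong (suc (length r) ∷_) (delZeros-map-length F)

dropEmpty-nonEmpty : ∀ F → All NonEmpty (dropEmpty F)
dropEmpty-nonEmpty [] = []
dropEmpty-nonEmpty ([] ∷ F) = dropEmpty-nonEmpty F
dropEmpty-nonEmpty ((x ∷ r) ∷ F) = s≤s z≤n ∷ dropEmpty-nonEmpty F

All-dropEmpty : ∀ {U : List ℕ → Set} F → All U F → All U (dropEmpty F)
All-dropEmpty [] [] = []
All-dropEmpty ([] ∷ F) (_ ∷ a) = All-dropEmpty F a
All-dropEmpty ((y ∷ s) ∷ F) (p ∷ a) = p ∷ All-dropEmpty F a

All-dropEmpty⁻ : ∀ {U : List ℕ → Set} → U [] → ∀ F → All U (dropEmpty F) → All U F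
All-dropEmpty⁻ u0 [] [] = []
All-dropEmpty⁻ u0 ([] ∷ F) a = u0 ∷ All-dropEmpty⁻ u0 F a
All-dropEmpty⁻ u0 ((y ∷ s) ∷ F) (p ∷ a) = p ∷ All-dropEmpty⁻ u0 F a

AllPairs-dropEmpty : ∀ {R : List ℕ → List ℕ → Set} F → AllPairs R F → AllPairs R (dropEmpty F)
AllPairs-dropEmpty [] [] = []
AllPairs-dropEmpty ([] ∷ F) (_ ∷ h) = AllPairs-dropEmpty F h
AllPairs-dropEmpty ((x ∷ r) ∷ F) (a ∷ h) = All-dropEmpty F a ∷ AllPairs-dropEmpty F h

AllPairs-dropEmpty⁻ : ∀ {R : List ℕ → List ℕ → Set} → (∀ r → R [] r) → (∀ r → R r []) →
  ∀ F → AllPairs R (dropEmpty F) → AllPairs R F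
AllPairs-dropEmpty⁻ empty-r r-empty [] [] = []
AllPairs-dropEmpty⁻ {R} empty-r r-empty ([] ∷ F) h =
  All-dropEmpty⁻ (empty-r []) F (allWithEmpty (dropEmpty F)) ∷ AllPairs-dropEmpty⁻ empty-r r-empty F h
  where
  allWithEmpty : ∀ rs → All (R []) rs
  allWithEmpty [] = []
  allWithEmpty (x ∷ xs) = empty-r x ∷ allWithEmpty xs
AllPairs-dropEmpty⁻ empty-r r-empty ((x ∷ r) ∷ F) (a ∷ h) =
  All-dropEmpty⁻ (r-empty (x ∷ r)) F a ∷ AllPairs-dropEmpty⁻ empty-r r-empty F h

Placed : ℕ → List (List ℕ) → Set
Placed c [] = ⊤
Placed c (r ∷ F) = (NonEmpty r → firstEntry r ≡ suc c) × Placed (suc c) F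

FirstEntriesIncreasingFrom : ℕ → List (List ℕ) → Set
FirstEntriesIncreasingFrom c [] = ⊤
FirstEntriesIncreasingFrom c (r ∷ t) = c < firstEntry r × FirstEntriesIncreasingFrom (firstEntry r) t

placeRows-placed : ∀ c t → FirstEntriesIncreasingFrom c t → Placed c (placeRows c t)
placeRows-placed c [] _ = tt
placeRows-placed c (r ∷ t) (c<r , rest) = withEmptyRows-placed c (firstEntry r ∸ suc c)
  ((λ _ → sym position≡) , subst (λ z → Placed z (placeRows (firstEntry r) t)) (sym position≡) (placeRows-placed (firstEntry r) t rest))
  where
  position≡ : suc (c + (firstEntry r ∸ suc c)) ≡ firstEntry r
  position≡ = trans (sym (+-suc c (firstEntry r ∸ suc c))) (trans (cong (c +_) (sym (+-∸-assoc 1 c<r))) (m+[n∸m]≡n (<⇒≤ c<r)))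
  withEmptyRows-placed : ∀ c n → Placed (c + n) (r ∷ placeRows (firstEntry r) t) → Placed c (withEmptyRows n (r ∷ placeRows (firstEntry r) t))
  withEmptyRows-placed c zero h = subst (λ z → Placed z (r ∷ placeRows (firstEntry r) t)) (+-identityʳ c) h
  withEmptyRows-placed c (suc n) h =
    (λ ()) , withEmptyRows-placed (suc c) n (subst (λ z → Placed z (r ∷ placeRows (firstEntry r) t)) (+-suc c n) h)

index⇒Placed : ∀ c F → (∀ i → 1 ≤ i → i ≤ length F → NonEmpty (rowOf F i) → firstEntry (rowOf F i) ≡ c + i) → Placed c F
index⇒Placed c [] h = tt
index⇒Placed c (r ∷ F) h = (λ ne → trans (h 1 ≤-refl (s≤s z≤n) ne) (+-comm c 1)) ,
  index⇒Placed (suc c) F (λ { (suc i) _ il ne → trans (h (suc (suc i)) (s≤s z≤n) (s≤s il) ne) (+-suc c (suc i)) })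

Placed⇒index : ∀ c F → Placed c F → ∀ i → 1 ≤ i → i ≤ length F → NonEmpty (rowOf F i) → firstEntry (rowOf F i) ≡ c + i
Placed⇒index c (r ∷ F) (h , _) (suc zero) _ _ ne = trans (h ne) (+-comm 1 c)
Placed⇒index c (r ∷ F) (_ , h) (suc (suc i)) _ (s≤s il) ne =
  trans (Placed⇒index (suc c) F h (suc i) (s≤s z≤n) il ne) (sym (+-suc c (suc i)))

Placed⇒firstEntries> : ∀ c F → Placed c F → All (λ r → c < firstEntry r) (dropEmpty F)
Placed⇒firstEntries> c [] _ = []
Placed⇒firstEntries> c ([] ∷ F) (_ , h) = All.map (<-trans (n<1+n c)) (Placed⇒firstEntries> (suc c) F h)
Placed⇒firstEntries> c ((x ∷ r) ∷ F) (h , h') =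
  subst (c <_) (sym (h (s≤s z≤n))) ≤-refl ∷ All.map (<-trans (n<1+n c)) (Placed⇒firstEntries> (suc c) F h')

LastNonEmpty : List (List ℕ) → Set
LastNonEmpty [] = ⊤
LastNonEmpty (r ∷ []) = NonEmpty r
LastNonEmpty (r ∷ s ∷ F) = LastNonEmpty (s ∷ F)

placeRows-dropEmpty : ∀ c F → Placed c F → LastNonEmpty F → placeRows c (dropEmpty F) ≡ F
placeRows-dropEmpty c [] _ _ = refl
placeRows-dropEmpty c ([] ∷ s ∷ F) (_ , h) last = trans
  (placeRows-oneGap (dropEmpty (s ∷ F)) (dropEmpty-someRow s F last) (Placed⇒firstEntries> (suc c) (s ∷ F) h))
  (cong ([] ∷_) (placeRows-dropEmpty (suc c) (s ∷ F) h last))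
  where
  dropEmpty-someRow : ∀ s F → LastNonEmpty (s ∷ F) → 1 ≤ length (dropEmpty (s ∷ F))
  dropEmpty-someRow (x ∷ r) [] _ = s≤s z≤n
  dropEmpty-someRow (x ∷ r) (s' ∷ F) _ = s≤s z≤n
  dropEmpty-someRow [] (s' ∷ F) l = dropEmpty-someRow s' F l
  placeRows-oneGap : ∀ t → 1 ≤ length t → All (λ r → suc c < firstEntry r) t → placeRows c t ≡ [] ∷ placeRows (suc c) t
  placeRows-oneGap (r ∷ t) _ (b ∷ _) rewrite +-∸-assoc 1 {firstEntry r} {suc (suc c)} b = refl
placeRows-dropEmpty c ((x ∷ r) ∷ F) (h , h') last with h (s≤s z≤n)
... | refl rewrite n∸n≡0 c = cong ((suc c ∷ r) ∷_) (placeRows-dropEmpty (suc c) F h' (lastNonEmpty-tail F last))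
  where
  lastNonEmpty-tail : ∀ F → LastNonEmpty ((suc c ∷ r) ∷ F) → LastNonEmpty F
  lastNonEmpty-tail [] _ = tt
  lastNonEmpty-tail (s ∷ F) l = l

ComTTriple : List ℕ → List ℕ → Set
ComTTriple r r' = ∀ k → 2 ≤ k → get0 r' k ≢ 0 → get0 r k ≤ get0 r' k → get0 r (k ∸ 1) < get0 r' k

ComTTriple-[]ʳ : ∀ r → ComTTriple r []
ComTTriple-[]ʳ r k _ nz _ = ⊥-elim (nz refl)

ComTTriple-[]ˡ : ∀ r → ComTTriple [] r
ComTTriple-[]ˡ r (suc zero) (s≤s ()) _ _
ComTTriple-[]ˡ r (suc (suc k)) _ nz _ = n≢0⇒n>0 nz

ProperRow : List ℕ → Set
ProperRow r = (∀ k → 2 ≤ k → k ≤ length r → get0 r k ≤ get0 r (k ∸ 1)) × (∀ k → 1 ≤ k → k ≤ length r → 1 ≤ get0 r k)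

ProperRow-[] : ProperRow []
ProperRow-[] = (λ { (suc (suc k)) _ () }) , (λ { (suc k) _ () })

FirstEntryLess : List ℕ → List ℕ → Set
FirstEntryLess r r' = NonEmpty r → NonEmpty r' → firstEntry r < firstEntry r'

rows⇒IsComT : ∀ t → All ProperRow t → All NonEmpty t → AllPairs ComTTriple t → AllPairs FirstEntryLess t →
  IsComT (map length t) t
rows⇒IsComT t proper nonEmpty triples increasing = record
  { length≡ = sym (length-map length t)
  ; rowLength = λ i _ _ → sym (get0-map-length t i)
  ; positive = λ i k li iℓ lk ka → proj₂ (All-rowOf t proper i li (inRange iℓ)) k lk (inRow i ka)
  ; rowDecreasing = λ i k li iℓ lk ka → proj₁ (All-rowOf t proper i li (inRange iℓ)) k lk (inRow i ka)
  ; firstColumnIncreasing = λ i li iℓ → AllPairs-rowOf t increasing i (suc i) li ≤-refl (next i li iℓ)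
      (All-rowOf t nonEmpty i li (≤-trans (n≤1+n i) (next i li iℓ))) (All-rowOf t nonEmpty (suc i) (s≤s z≤n) (next i li iℓ))
  ; triple = λ i j k li iℓ lj jℓ lk km i<j nz le → AllPairs-rowOf t triples i j li i<j (inRange jℓ) k lk nz le
  }
  where
  inRange : ∀ {i} → i ≤ length (map length t) → i ≤ length t
  inRange {i} h = subst (i ≤_) (length-map length t) h
  inRow : ∀ {k} i → k ≤ get0 (map length t) i → k ≤ length (rowOf t i)
  inRow {k} i h = subst (k ≤_) (get0-map-length t i) h
  next : ∀ i → 1 ≤ i → i ≤ length (map length t) ∸ 1 → suc i ≤ length t
  next i li h with length t | length-map length t
  ... | zero | e = ⊥-elim (<⇒≱ li (subst (λ z → i ≤ z ∸ 1) e h))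
  ... | suc n | e = s≤s (subst (λ z → i ≤ z ∸ 1) e h)

module ComTRows (α : List ℕ) (t : List (List ℕ)) (c : IsComT α t) (αpos : All (0 <_) α) where
  open IsComT c

  private
    inRange : ∀ i → i ≤ length t → i ≤ length α
    inRange i h = subst (i ≤_) length≡ h

    rowLength′ : ∀ i → 1 ≤ i → i ≤ length t → length (rowOf t i) ≡ get0 α i
    rowLength′ i li h = rowLength i li (inRange i h)

  rows-nonEmpty : All NonEmpty t
  rows-nonEmpty = rowOf-All t (λ p lp pl → subst (1 ≤_) (sym (rowLength′ p lp pl)) (All-get0 α αpos p lp (inRange p pl)))

  rows-proper : All ProperRow t
  rows-proper = rowOf-All t (λ p lp pl →
    (λ k lk kl → rowDecreasing p k lp (inRange p pl) lk (subst (k ≤_) (rowLength′ p lp pl) kl)) ,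
    (λ k lk kl → positive p k lp (inRange p pl) lk (subst (k ≤_) (rowLength′ p lp pl) kl)))

  rows-triples : AllPairs ComTTriple t
  rows-triples = rowOf-AllPairs t (λ p q lp pq ql k lk nz le →
    triple p q k lp (inRange p (≤-trans (<⇒≤ pq) ql)) (≤-trans lp (<⇒≤ pq)) (inRange q ql) lk (k≤maxL q k nz) pq nz le)
    where
    rowLength″ : ∀ q → length (rowOf t q) ≡ get0 α q
    rowLength″ zero rewrite rowOf-zero t = sym (get0-zero α)
    rowLength″ (suc q) with suc q ≤? length t
    ... | yes h = rowLength′ (suc q) (s≤s z≤n) h
    ... | no h rewrite rowOf-outOfRange t (suc q) (≰⇒> h) = sym (get0-outOfRange α (suc q) (subst (_< suc q) length≡ (≰⇒> h)))
    k≤maxL : ∀ q k → get0 (rowOf t q) k ≢ 0 → k ≤ maxL α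
    k≤maxL q k nz with k ≤? maxL α
    ... | yes h = h
    ... | no h = ⊥-elim (nz (get0-outOfRange (rowOf t q) k
                   (≤-<-trans (subst (_≤ maxL α) (sym (rowLength″ q)) (get0≤maxL α q)) (≰⇒> h))))

  rows-firstEntriesIncreasing : FirstEntriesIncreasingFrom 0 t
  rows-firstEntriesIncreasing = from 0 t
    (λ p lp sp → firstColumnIncreasing p lp (∸-monoˡ-≤ 1 (inRange (suc p) sp)))
    (λ l → positive 1 1 ≤-refl (inRange 1 l) ≤-refl (subst (1 ≤_) (rowLength′ 1 ≤-refl l) (All-rowOf t rows-nonEmpty 1 ≤-refl l)))
    where
    from : ∀ c (s : List (List ℕ)) → (∀ p → 1 ≤ p → suc p ≤ length s → firstEntry (rowOf s p) < firstEntry (rowOf s (suc p))) →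
      (1 ≤ length s → c < firstEntry (rowOf s 1)) → FirstEntriesIncreasingFrom c s
    from c [] _ _ = tt
    from c (r ∷ s) increasing first = first (s≤s z≤n) ,
      from (firstEntry r) s (λ { (suc p) _ sp → increasing (suc (suc p)) (s≤s z≤n) (s≤s sp) }) (λ l → increasing 1 ≤-refl (s≤s l))

  shape≡map-length : α ≡ map length t
  shape≡map-length = get0-ext α (map length t) (trans (sym length≡) (sym (length-map length t)))
    (λ k lk kl → trans (sym (rowLength′ k lk (subst (k ≤_) (sym length≡) kl))) (sym (get0-map-length t k)))

lastPositive-++ : ∀ xs y ys → lastPositive (xs ++ y ∷ ys) ≡ lastPositive (y ∷ ys)
lastPositive-++ [] y ys = refl
lastPositive-++ (x ∷ []) y ys = refl
lastPositive-++ (x ∷ x' ∷ xs) y ys = lastPositive-++ (x' ∷ xs) y ys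

lastPositive-placeRows : ∀ c t → All NonEmpty t → 1 ≤ length t → T (lastPositive (map length (placeRows c t)))
lastPositive-placeRows c (r ∷ t) (ne ∷ nes) _ =
  subst T (sym (trans (cong lastPositive (map-++ length (replicate (firstEntry r ∸ suc c) []) (r ∷ placeRows (firstEntry r) t)))
    (lastPositive-++ (map length (replicate (firstEntry r ∸ suc c) [])) (length r) (map length (placeRows (firstEntry r) t)))))
    (lastRow t nes)
  where
  lastRow : ∀ t → All NonEmpty t → T (lastPositive (length r ∷ map length (placeRows (firstEntry r) t)))
  lastRow [] _ = <⇒<ᵇ ne
  lastRow (r' ∷ t') nes' = subst T (sym (lastPositive-∷ (length r) (map length (placeRows (firstEntry r) (r' ∷ t'))) (placeRows-someRow (firstEntry r' ∸ suc (firstEntry r)))))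
    (lastPositive-placeRows (firstEntry r) (r' ∷ t') nes' (s≤s z≤n))
    where
    lastPositive-∷ : ∀ x ys → 1 ≤ length ys → lastPositive (x ∷ ys) ≡ lastPositive ys
    lastPositive-∷ x (y ∷ ys) _ = refl
    placeRows-someRow : ∀ n → 1 ≤ length (map length (withEmptyRows n (r' ∷ placeRows (firstEntry r') t')))
    placeRows-someRow zero = s≤s z≤n
    placeRows-someRow (suc n) = s≤s z≤n

lastPositive⇒LastNonEmpty : ∀ F → T (lastPositive (map length F)) → LastNonEmpty F
lastPositive⇒LastNonEmpty [] _ = tt
lastPositive⇒LastNonEmpty (r ∷ []) h = <ᵇ⇒< _ _ h
lastPositive⇒LastNonEmpty (r ∷ s ∷ F) h = lastPositive⇒LastNonEmpty (s ∷ F) h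

eqL⇒≡ : ∀ xs ys → T (eqL xs ys) → xs ≡ ys
eqL⇒≡ [] [] _ = refl
eqL⇒≡ (x ∷ xs) (y ∷ ys) h = cong₂ _∷_ (≡ᵇ⇒≡ _ _ (∧-fst {x ≡ᵇ y} h)) (eqL⇒≡ xs ys (∧-snd {x ≡ᵇ y} h))

eqL-refl : ∀ xs → T (eqL xs xs)
eqL-refl [] = tt
eqL-refl (x ∷ xs) = ∧-intro (≡⇒≡ᵇ x x refl) (eqL-refl xs)

-- The bijection

module SSAFRows (F : List (List ℕ)) (s : IsSSAF F) where
  open IsSSAF s

  private
    n : ℕ
    n = length (map length F)
    inRow : ∀ {k} i → k ≤ length (rowOf F i) → k ≤ get0 (map length F) i
    inRow {k} i h = subst (k ≤_) (sym (get0-map-length F i)) h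
    inRange : ∀ {i} → i ≤ length F → i ≤ n
    inRange {i} h = subst (i ≤_) (sym (length-map length F)) h

  -- The first entry is at most the basement entry i, and an entry v < i would
  -- attack the basement of row v.
  firstEntry≡row : ∀ i → 1 ≤ i → i ≤ n → NonEmpty (rowOf F i) → firstEntry (rowOf F i) ≡ i
  firstEntry≡row i li iN ne with <-cmp (firstEntry (rowOf F i)) i
  ... | tri≈ _ e _ = e
  ... | tri> _ _ gt = ⊥-elim (<⇒≱ gt (rowDecreasing i li iN 1 ≤-refl (inRow i ne)))
  ... | tri< lt _ _ = ⊥-elim (diagonalDistinct i (firstEntry (rowOf F i)) li iN (positive i li iN 1 ≤-refl ne)
                        (≤-trans (<⇒≤ lt) iN) lt 1 ≤-refl (inRow i ne) z≤n refl)

  augmented-decreasing : ∀ i → 1 ≤ i → i ≤ n → ∀ k → 1 ≤ k → k ≤ length (rowOf F i) →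
    augmented i (rowOf F i) k ≤ augmented i (rowOf F i) (k ∸ 1)
  augmented-decreasing i li iN k lk kl = rowDecreasing i li iN k lk (inRow i kl)

  augmented-positive : ∀ i → 1 ≤ i → i ≤ n → ∀ k → 1 ≤ k → k ≤ length (rowOf F i) → 1 ≤ augmented i (rowOf F i) k
  augmented-positive i li iN (suc k) lk kl = positive i li iN (suc k) lk kl

  rowPair-comTTriple : ∀ i j → 1 ≤ i → i < j → j ≤ n → ComTTriple (rowOf F i) (rowOf F j)
  rowPair-comTTriple i j li i<j jN (suc (suc k)) _ = FromSSAF.comTTriples sameColumn diagonal typeA′ typeB′ (suc (suc k)) (s≤s (s≤s z≤n))
    where
    lj : 1 ≤ j
    lj = ≤-trans li (<⇒≤ i<j)
    iN : i ≤ n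
    iN = ≤-trans (<⇒≤ i<j) jN
    open RowPair i j i<j (rowOf F i) (rowOf F j) (augmented-decreasing i li iN) (augmented-decreasing j lj jN)
      (augmented-positive i li iN) (augmented-positive j lj jN) (firstEntry≡row i li iN) (firstEntry≡row j lj jN)
    sameColumn : SameColumnDistinct
    sameColumn k ka kb = sameColumnDistinct i j li iN lj jN i<j k (inRow i ka) (inRow j kb)
    diagonal : DiagonalDistinct
    diagonal k lk kb ka = diagonalDistinct j i lj jN li iN i<j k lk (inRow j kb) (inRow i ka)
    typeA′ : TypeATriples
    typeA′ le k lk kb = typeA i j li iN lj jN i<j (subst₂ _≤_ (sym (get0-map-length F j)) (sym (get0-map-length F i)) le) k lk (inRow j kb)
    typeB′ : TypeBTriples
    typeB′ le k ka = typeB i j li iN lj jN i<j (subst₂ _<_ (sym (get0-map-length F i)) (sym (get0-map-length F j)) le) k (inRow i ka)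
  rowPair-comTTriple i j li i<j jN (suc zero) (s≤s ())

  row-proper : ∀ i → 1 ≤ i → i ≤ length F → ProperRow (rowOf F i)
  row-proper i li il = decreasing , λ k lk kl → positive i li (inRange il) k lk kl
    where
    decreasing : ∀ k → 2 ≤ k → k ≤ length (rowOf F i) → get0 (rowOf F i) k ≤ get0 (rowOf F i) (k ∸ 1)
    decreasing (suc zero) (s≤s ()) _
    decreasing (suc (suc k)) _ kl = augmented-decreasing i li (inRange il) (suc (suc k)) (s≤s z≤n) kl

  dropEmpty-IsComT : IsComT (map length (dropEmpty F)) (dropEmpty F)
  dropEmpty-IsComT = rows⇒IsComT (dropEmpty F)
    (All-dropEmpty F (rowOf-All F row-proper))
    (dropEmpty-nonEmpty F)
    (AllPairs-dropEmpty F (rowOf-AllPairs F (λ p q lp pq ql → rowPair-comTTriple p q lp pq (inRange ql))))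
    (AllPairs-dropEmpty F (rowOf-AllPairs F (λ p q lp pq ql nep neq →
      subst₂ _<_ (sym (firstEntry≡row p lp (inRange (≤-trans (<⇒≤ pq) ql)) nep)) (sym (firstEntry≡row q (≤-trans lp (<⇒≤ pq)) (inRange ql) neq)) pq)))

  placed : Placed 0 F
  placed = index⇒Placed 0 F (λ i li il ne → firstEntry≡row i li (inRange il) ne)

module ComTPlacement (α : List ℕ) (t : List (List ℕ)) (c : IsComT α t) (αpos : All (0 <_) α) where
  open ComTRows α t c αpos

  F : List (List ℕ)
  F = placeRows 0 t

  private
    n : ℕ
    n = length (map length F)
    inRange : ∀ {i} → i ≤ n → i ≤ length F
    inRange {i} h = subst (i ≤_) (length-map length F) h
    inRow : ∀ {k} i → k ≤ get0 (map length F) i → k ≤ length (rowOf F i)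
    inRow {k} i h = subst (k ≤_) (get0-map-length F i) h

  dropEmpty-F : dropEmpty F ≡ t
  dropEmpty-F = dropEmpty-placeRows 0 t rows-nonEmpty

  firstEntry≡row : ∀ i → 1 ≤ i → i ≤ n → NonEmpty (rowOf F i) → firstEntry (rowOf F i) ≡ i
  firstEntry≡row i li iN ne = Placed⇒index 0 F (placeRows-placed 0 t rows-firstEntriesIncreasing) i li (inRange iN) ne

  private
    proper : ∀ i → 1 ≤ i → i ≤ n → ProperRow (rowOf F i)
    proper i li iN = All-rowOf F (All-dropEmpty⁻ ProperRow-[] F (subst (All ProperRow) (sym dropEmpty-F) rows-proper)) i li (inRange iN)

    triples : AllPairs ComTTriple F
    triples = AllPairs-dropEmpty⁻ ComTTriple-[]ˡ ComTTriple-[]ʳ F (subst (AllPairs ComTTriple) (sym dropEmpty-F) rows-triples)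

    augmented-decreasing : ∀ i → 1 ≤ i → i ≤ n → ∀ k → 1 ≤ k → k ≤ length (rowOf F i) →
      augmented i (rowOf F i) k ≤ augmented i (rowOf F i) (k ∸ 1)
    augmented-decreasing i li iN (suc zero) lk kl = ≤-reflexive (firstEntry≡row i li iN kl)
    augmented-decreasing i li iN (suc (suc k)) lk kl = proj₁ (proper i li iN) (suc (suc k)) (s≤s (s≤s z≤n)) kl

    augmented-positive : ∀ i → 1 ≤ i → i ≤ n → ∀ k → 1 ≤ k → k ≤ length (rowOf F i) → 1 ≤ augmented i (rowOf F i) k
    augmented-positive i li iN (suc k) lk kl = proj₂ (proper i li iN) (suc k) lk kl

    module Pair (i j : ℕ) (li : 1 ≤ i) (i<j : i < j) (jN : j ≤ n) where
      lj : 1 ≤ j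
      lj = ≤-trans li (<⇒≤ i<j)
      iN : i ≤ n
      iN = ≤-trans (<⇒≤ i<j) jN
      open RowPair i j i<j (rowOf F i) (rowOf F j) (augmented-decreasing i li iN) (augmented-decreasing j lj jN)
        (augmented-positive i li iN) (augmented-positive j lj jN) (firstEntry≡row i li iN) (firstEntry≡row j lj jN) public
      comTTriples : ComTTriples
      comTTriples (suc zero) (s≤s ())
      comTTriples (suc (suc k)) _ = AllPairs-rowOf F triples i j li i<j (inRange jN) (suc (suc k)) (s≤s (s≤s z≤n))
      open FromComT comTTriples public

  F-IsSSAF : IsSSAF F
  F-IsSSAF = record
    { positive = λ i li iN k lk kl → proj₂ (proper i li iN) k lk kl
    ; rowDecreasing = λ i li iN k lk kL → augmented-decreasing i li iN k lk (inRow i kL)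
    ; sameColumnDistinct = λ i i' li _ _ i'N lt j jL jL' → Pair.sameColumnDistinct i i' li lt i'N j (inRow i jL) (inRow i' jL')
    ; diagonalDistinct = λ i i' _ iN li' _ lt j lj jL jL' → Pair.diagonalDistinct i' i li' lt iN j lj (inRow i jL) (inRow i' jL')
    ; typeA = λ i j li _ _ jN lt le k lk kL →
        Pair.typeATriples i j li lt jN (subst₂ _≤_ (get0-map-length F j) (get0-map-length F i) le) k lk (inRow j kL)
    ; typeB = λ i j li _ _ jN lt le k kL →
        Pair.typeBTriples i j li lt jN (subst₂ _<_ (get0-map-length F i) (get0-map-length F j) le) k (inRow i kL)
    }

module Bijection (α β : List ℕ) (αpos : All (0 <_) α) (α-nonEmpty : 1 ≤ length α) where

  private
    ssafCondition : List ℕ × List (List ℕ) → Bool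
    ssafCondition (γ , F) = lastPositive γ ∧ eqL (delZeros γ) α ∧ isSSAF γ F ∧ weightOK β (concat F)
    comTCondition : List (List ℕ) → Bool
    comTCondition t = isComT α t ∧ weightOK β (concat t)

  module FromSSAF (γ : List ℕ) (F : List (List ℕ)) (ok : T (ssafCondition (γ , F))) where
    private
      lastOK : T (lastPositive γ)
      lastOK = ∧-fst {lastPositive γ} ok
      shapeMatches : T (eqL (delZeros γ) α)
      shapeMatches = ∧-fst {eqL (delZeros γ) α} (∧-snd {lastPositive γ} ok)
      ssafOK : T (isSSAF γ F)
      ssafOK = ∧-fst {isSSAF γ F} (∧-snd {eqL (delZeros γ) α} (∧-snd {lastPositive γ} ok))
      weightMatches : T (weightOK β (concat F))
      weightMatches = ∧-snd {isSSAF γ F} (∧-snd {eqL (delZeros γ) α} (∧-snd {lastPositive γ} ok))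

    γ≡ : γ ≡ map length F
    γ≡ = shapeOK⇒≡map-length γ F (∧-fst {shapeOK γ F} ssafOK)

    open SSAFRows F (isSSAF⇒IsSSAF F (subst (λ g → T (isSSAF g F)) γ≡ ssafOK))

    comT : T (comTCondition (dropEmpty F))
    comT = ∧-intro (IsComT⇒isComT α (dropEmpty F) (subst (λ a → IsComT a (dropEmpty F)) (sym α≡) dropEmpty-IsComT))
                   (subst (λ xs → T (weightOK β xs)) (sym (concat-dropEmpty F)) weightMatches)
      where
      α≡ : α ≡ map length (dropEmpty F)
      α≡ = trans (sym (eqL⇒≡ (delZeros γ) α shapeMatches)) (trans (cong delZeros γ≡) (delZeros-map-length F))

    placeRows-dropEmpty-F : placeRows 0 (dropEmpty F) ≡ F
    placeRows-dropEmpty-F = placeRows-dropEmpty 0 F placed (lastPositive⇒LastNonEmpty F (subst (λ g → T (lastPositive g)) γ≡ lastOK))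

  module FromComT (t : List (List ℕ)) (ok : T (comTCondition t)) where
    c : IsComT α t
    c = isComT⇒IsComT α t (∧-fst {isComT α t} ok)
    open ComTRows α t c αpos
    open ComTPlacement α t c αpos

    ssaf : T (ssafCondition (map length F , F))
    ssaf = ∧-intro (lastPositive-placeRows 0 t rows-nonEmpty (subst (1 ≤_) (sym (IsComT.length≡ c)) α-nonEmpty))
      (∧-intro (subst (λ z → T (eqL z α)) (sym (trans (delZeros-map-length F) (trans (cong (map length) dropEmpty-F) (sym shape≡map-length)))) (eqL-refl α))
      (∧-intro (IsSSAF⇒isSSAF F F-IsSSAF) (subst (λ xs → T (weightOK β xs)) (sym (concat-placeRows 0 t)) (∧-snd {isComT α t} ok))))

  toComT : SSAFsOfWeight α β → ComTsOfWeight α β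
  toComT ((γ , F) , ok) = dropEmpty F , FromSSAF.comT γ F ok

  toSSAF : ComTsOfWeight α β → SSAFsOfWeight α β
  toSSAF (t , ok) = (map length (placeRows 0 t) , placeRows 0 t) , FromComT.ssaf t ok

  toComT∘toSSAF : ∀ t → toComT (toSSAF t) ≡ t
  toComT∘toSSAF (t , ok) = Σ-T-≡ {P = comTCondition} (ComTPlacement.dropEmpty-F α t (FromComT.c t ok) αpos)

  toSSAF∘toComT : ∀ F → toSSAF (toComT F) ≡ F
  toSSAF∘toComT ((γ , F) , ok) = Σ-T-≡ {P = ssafCondition}
    (cong₂ _,_ (trans (cong (map length) (FromSSAF.placeRows-dropEmpty-F γ F ok)) (sym (FromSSAF.γ≡ γ F ok)))
               (FromSSAF.placeRows-dropEmpty-F γ F ok))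

  ssaf↔comT : SSAFsOfWeight α β ↔ ComTsOfWeight α β
  ssaf↔comT = mk↔ₛ′ toComT toSSAF toComT∘toSSAF toSSAF∘toComT

composition-nonEmpty : ∀ n α → 0 < n → IsComposition n α → 1 ≤ length α
composition-nonEmpty n [] 0<n (_ , sum≡n) = ⊥-elim (<⇒≢ 0<n sum≡n)
composition-nonEmpty n (x ∷ α) _ _ = s≤s z≤n

↔-empty : ∀ {A : Set} → ¬ A → A ↔ Fin 0
↔-empty ¬a = mk↔ₛ′ (λ a → ⊥-elim (¬a a)) (λ ()) (λ ()) (λ a → ⊥-elim (¬a a))

↔-singleton : ∀ {A : Set} (a : A) → (∀ x → x ≡ a) → A ↔ Fin 1
↔-singleton a unique = mk↔ₛ′ (λ _ → zero) (λ _ → a) (λ { zero → refl }) (λ x → sym (unique x))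

proposition6p14 : (n : ℕ) → 0 < n → (α β : List ℕ) → IsComposition n α → IsComposition n β →
    (SSAFsOfWeight α β ↔ ComTsOfWeight α β)
    × (β ▶ α → SSAFsOfWeight α β ↔ Fin 0)
    × (SSAFsOfWeight α α ↔ Fin 1)
proposition6p14 n 0<n α β cα@(αpos , _) (βpos , _) = ssaf↔comT , none-below , exactlyOne
  where
  α-nonEmpty : 1 ≤ length α
  α-nonEmpty = composition-nonEmpty n α 0<n cα
  open Bijection α β αpos α-nonEmpty
  module Diagonal = Bijection α α αpos α-nonEmpty
  none-below : β ▶ α → SSAFsOfWeight α β ↔ Fin 0
  none-below β▶α = ↔-empty (λ F → noComT-below α β αpos βpos β▶α (toComT F))
  exactlyOne : SSAFsOfWeight α α ↔ Fin 1
  exactlyOne = ↔-singleton (Diagonal.toSSAF (constantRows-ComT α αpos)) (λ F → begin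
    F                                          ≡⟨ Diagonal.toSSAF∘toComT F ⟨
    Diagonal.toSSAF (Diagonal.toComT F)        ≡⟨ cong Diagonal.toSSAF (comT-ofOwnWeight-unique α αpos (Diagonal.toComT F)) ⟩
    Diagonal.toSSAF (constantRows-ComT α αpos) ∎)
    where open ≡-Reasoning
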